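{- Let $n > 3$ and let $C_n$ be the labeled cycle graph on vertex set $\{1,2,\dots,n\}$ with edges $\{k,k+1\}$ for $1 \le k \le n-1$ together with $\{n,1\}$. Let \[ w_n = 1\, n\, 2\, 1\, 3\, 2\, 4\, 3\, 5\, 4 \cdots (n-1)\,(n-2)\, n\,(n-1), \] i.e. $w_n$ is the word of length $2n$ consisting of the letters $1, n$ followed, for $k = 2, 3, \dots, n$ in turn, by the two letters $k, k-1$. Then there are exactly $4n$ distinct $2$-uniform words $w$ on the alphabet $\{1,\dots,n\}$ with $G(w) = C_n$, and each of them is either a cyclic shift (rotation) of $w_n$ or the reversal (reflection) of a cyclic shift of $w_n$.
   Context: For a word $w$ over an alphabet $\Sigma$ and letters $a,b$, the residual word $w_{a,b}$ is obtained from $w$ by deleting all letters other than $a$ and $b$. Letters $a$ and $b$ occurring in $w$ alternate in $w$ if $w_{a,b}$ contains no two consecutive equal letters. The alternating symbol graph $G(w)$ is the graph with vertex set $\Sigma$ in which $a$ and $b$ are adjacent iff $a$ and $b$ alternate in $w$. A word $w$ represents a graph $G$ if $G(w) = G$. A word is $k$-uniform if every letter of the alphabet occurs in it exactly $k$ times. A rotation (cyclic shift) of $w = x_1 x_2 \cdots x_m$ is a word $x_{i+1} \cdots x_m x_1 \cdots x_i$ for some $0 \le i \le m-1$; a reflection of $w$ is its reversal $x_m x_{m-1} \cdots x_1$. -}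

module Defs where

open import Data.Nat using (ℕ; zero; suc; _+_; _*_; _∸_; _≤_; _<_)
open import Data.Nat.Properties using (_≟_)
open import Data.List using (List; []; _∷_; _++_; filter; length; take; drop; reverse; upTo; concatMap)
open import Data.List.Membership.Propositional using (_∈_)
open import Data.Product using (_×_; Σ)
open import Data.Sum using (_⊎_)
open import Data.Unit using (⊤)
open import Relation.Nullary using (¬_)
open import Relation.Nullary.Decidable using (_⊎-dec_)
open import Relation.Binary.PropositionalEquality using (_≡_; _≢_)
open import Function.Bundles using (_⇔_)

Word : Set
Word = List ℕ

occ : ℕ → Word → ℕ
occ a w = length (filter (_≟ a) w)

InAlph : ℕ → ℕ → Set
InAlph n a = (1 ≤ a) × (a ≤ n)

Uniform : ℕ → ℕ → Word → Set
Uniform k n w = (∀ x → x ∈ w → InAlph n x) × (∀ a → InAlph n a → occ a w ≡ k)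

residual : Word → ℕ → ℕ → Word
residual w a b = filter (λ x → (x ≟ a) ⊎-dec (x ≟ b)) w

NoConsecEq : Word → Set
NoConsecEq [] = ⊤
NoConsecEq (x ∷ []) = ⊤
NoConsecEq (x ∷ y ∷ r) = (x ≢ y) × NoConsecEq (y ∷ r)

Alternate : Word → ℕ → ℕ → Set
Alternate w a b = (a ∈ w) × (b ∈ w) × NoConsecEq (residual w a b)

CycleAdj : ℕ → ℕ → ℕ → Set
CycleAdj n a b = (b ≡ suc a) ⊎ (a ≡ suc b) ⊎ ((a ≡ 1) × (b ≡ n)) ⊎ ((a ≡ n) × (b ≡ 1))

Represents : ℕ → Word → Set
Represents n w = ∀ a b → InAlph n a → InAlph n b → (Alternate w a b ⇔ CycleAdj n a b)

wordW : ℕ → Word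
wordW n = 1 ∷ n ∷ concatMap (λ i → (i + 2) ∷ (i + 1) ∷ []) (upTo (n ∸ 1))

rotate : ℕ → Word → Word
rotate i w = drop i w ++ take i w

-- Let c be the cyclic reading of a 2-uniform word w representing C_n, and write the word as
-- a v a x around the two occurrences of a letter a.  A letter alternates with a iff it occurs
-- exactly once in v, so the neighbours of a occur once in v, every other letter 0 or 2 times;
-- and since the non-neighbours of a form a path in C_n whose consecutive letters alternate,
-- they all occur in v or all in x.  Hence v or x consists of the two neighbours of a alone:
-- every letter recurs 3 positions later, flanking its two neighbours, or 3 positions earlier.
-- Two consecutive positions cannot both recur 3 positions later, so this happens at every
-- other position with a constant orientation, and c (q + 2) = next (c q) for all q or
-- c (q + 2) = prev (c q) for all q.  In the first case w is determined by its first two letters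
-- and is a rotation of w_n; in the second the reversal of w is in the first case, because no
-- word satisfies the same such recurrence read in both directions.  Finally the 2n rotations
-- of w_n are pairwise distinct and distinct from the 2n reflections.

module Submission where

open import Data.Bool using (true; false; if_then_else_)
open import Data.Empty using (⊥; ⊥-elim)
open import Data.List using (List; []; _∷_; _++_; [_]; filter; length; replicate; reverse; take; drop; concatMap; upTo; _∷ʳ_; applyUpTo)
open import Data.List.Membership.Propositional using (_∈_)
open import Data.List.Membership.Propositional.Properties using (∈-++⁺ˡ; ∈-++⁺ʳ; ∈-++⁻; ∈-applyUpTo⁺; ∈-applyUpTo⁻)
open import Data.List.Properties using (filter-++; filter-accept; filter-reject; filter-≐; length-++; ++-assoc; ++-identityʳ; reverse-++; unfold-reverse; length-reverse; reverse-involutive; reverse-injective; length-applyUpTo; drop-all; take-all; concatMap-++; upTo-∷ʳ)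
open import Data.List.Relation.Binary.Permutation.Propositional using (_↭_; ↭-sym)
open import Data.List.Relation.Binary.Permutation.Propositional.Properties using (↭-length; filter-↭; ∷↭∷ʳ; ↭-reverse)
open import Data.List.Relation.Unary.All as All using (All; []; _∷_)
import Data.List.Relation.Unary.All.Properties as Allₚ
import Data.List.Relation.Unary.AllPairs.Properties as AllPairsₚ
open import Data.List.Relation.Unary.Any using (here; there)
open import Data.List.Relation.Unary.Unique.Propositional using (Unique)
open import Data.Nat using (ℕ; zero; suc; _+_; _*_; _∸_; _≤_; _<_; z≤n; s≤s; pred; _<?_; _≤?_; _<ᵇ_)
open import Data.Nat.Induction using (<-rec)
open import Data.Nat.Properties
open import Algebra.Properties.CommutativeSemigroup +-commutativeSemigroup using (interchange; x∙yz≈y∙xz)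
open import Data.Product using (_×_; Σ; ∃-syntax; _,_; proj₁; proj₂)
open import Data.Sum using (_⊎_; inj₁; inj₂; swap; [_,_]′)
open import Data.Unit using (tt)
open import Function.Base using (_∘_)
open import Function.Bundles using (_⇔_; mk⇔; Equivalence)
open import Function.Construct.Composition using (_⇔-∘_)
open import Function.Construct.Symmetry using (⇔-sym)
open import Function.Endo.Propositional ℕ using (_^_; ^-homo)
open import Relation.Binary.PropositionalEquality using (_≡_; _≢_; refl; sym; trans; cong; cong₂; cong-app; ≢-sym; subst; subst₂; module ≡-Reasoning)
open import Relation.Nullary using (¬_; Dec; yes; no)
open import Relation.Nullary.Decidable using (_⊎-dec_)

open import Defs

-- Occurrences of letters

occ-here : ∀ {a x} xs → x ≡ a → occ a (x ∷ xs) ≡ suc (occ a xs)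
occ-here {a} xs x≡a = cong length (filter-accept (_≟ a) x≡a)

occ-there : ∀ {a x} xs → x ≢ a → occ a (x ∷ xs) ≡ occ a xs
occ-there {a} xs x≢a = cong length (filter-reject (_≟ a) x≢a)

occ-++ : ∀ a xs ys → occ a (xs ++ ys) ≡ occ a xs + occ a ys
occ-++ a xs ys = trans (cong length (filter-++ (_≟ a) xs ys)) (length-++ (filter (_≟ a) xs))

occ-↭ : ∀ a {xs ys} → xs ↭ ys → occ a xs ≡ occ a ys
occ-↭ a xs↭ys = ↭-length (filter-↭ (_≟ a) xs↭ys)

occ-reverse : ∀ a w → occ a (reverse w) ≡ occ a w
occ-reverse a w = occ-↭ a (↭-reverse w)

occ>0⇒∈ : ∀ {a} xs → 0 < occ a xs → a ∈ xs
occ>0⇒∈ {a} (x ∷ xs) p with x ≟ a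
... | yes refl = here refl
... | no x≢a = there (occ>0⇒∈ xs (subst (0 <_) (occ-there xs x≢a) p))

∈⇒occ>0 : ∀ {a xs} → a ∈ xs → 0 < occ a xs
∈⇒occ>0 {a} {x ∷ xs} (here refl) rewrite occ-here {a} xs refl = s≤s z≤n
∈⇒occ>0 {a} {x ∷ xs} (there a∈xs) with x ≟ a
... | yes x≡a rewrite occ-here xs x≡a = s≤s z≤n
... | no x≢a rewrite occ-there xs x≢a = ∈⇒occ>0 a∈xs

occ≡0⇒∉ : ∀ {a xs} → occ a xs ≡ 0 → ¬ a ∈ xs
occ≡0⇒∉ occ≡0 a∈xs = <⇒≢ (∈⇒occ>0 a∈xs) (sym occ≡0)

∈-resp-occ : ∀ {a w w′} → occ a w ≡ occ a w′ → a ∈ w → a ∈ w′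
∈-resp-occ {w′ = w′} eq a∈w = occ>0⇒∈ w′ (subst (0 <_) eq (∈⇒occ>0 a∈w))

occ≡1⇒split : ∀ a t → occ a t ≡ 1 →
  Σ Word λ v → Σ Word λ x → t ≡ v ++ a ∷ x × occ a v ≡ 0 × occ a x ≡ 0
occ≡1⇒split a (y ∷ t) eq with y ≟ a
... | yes refl = [] , t , refl , refl , suc-injective (trans (sym (occ-here t refl)) eq)
... | no y≢a with occ≡1⇒split a t (trans (sym (occ-there t y≢a)) eq)
... | v , x , refl , v₀ , x₀ = y ∷ v , x , refl , trans (occ-there v y≢a) v₀ , x₀

occ≡2⇒split : ∀ a t → occ a t ≡ 2 →
  Σ Word λ u → Σ Word λ v → Σ Word λ x →
    t ≡ u ++ a ∷ v ++ a ∷ x × occ a u ≡ 0 × occ a v ≡ 0 × occ a x ≡ 0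
occ≡2⇒split a (y ∷ t) eq with y ≟ a
... | yes refl with occ≡1⇒split a t (suc-injective (trans (sym (occ-here t refl)) eq))
...   | v , x , refl , v₀ , x₀ = [] , v , x , refl , refl , v₀ , x₀
occ≡2⇒split a (y ∷ t) eq | no y≢a with occ≡2⇒split a t (trans (sym (occ-there t y≢a)) eq)
... | u , v , x , refl , u₀ , v₀ , x₀ = y ∷ u , v , x , refl , trans (occ-there u y≢a) u₀ , v₀ , x₀

occ-split : ∀ {a b} u m x → a ≢ b → occ b (u ++ a ∷ m ++ a ∷ x) ≡ occ b u + (occ b m + occ b x)
occ-split {a} {b} u m x a≢b = begin
    occ b (u ++ a ∷ m ++ a ∷ x)
  ≡⟨ occ-++ b u _ ⟩
    occ b u + occ b (a ∷ m ++ a ∷ x)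
  ≡⟨ cong (occ b u +_) (trans (occ-there _ a≢b) (occ-++ b m _)) ⟩
    occ b u + (occ b m + occ b (a ∷ x))
  ≡⟨ cong (λ k → occ b u + (occ b m + k)) (occ-there x a≢b) ⟩
    occ b u + (occ b m + occ b x)
  ∎
  where open ≡-Reasoning

occ-outside : ∀ {d} P v Q → occ d (P ++ v ++ Q) ≡ 2 → occ d v ≡ 2 → occ d P ≡ 0 × occ d Q ≡ 0
occ-outside {d} P v Q d₂ dv₂ = m+n≡0⇒m≡0 _ p+q≡0 , m+n≡0⇒n≡0 (occ d P) p+q≡0
  where
  p : ℕ
  p = occ d P
  q : ℕ
  q = occ d Q
  p+q≡0 : p + q ≡ 0
  p+q≡0 = suc-injective (suc-injective (begin
      suc (suc (p + q))
    ≡⟨ cong suc (sym (+-suc p q)) ⟩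
      suc (p + suc q)
    ≡⟨ sym (+-suc p (suc q)) ⟩
      p + (2 + q)
    ≡⟨ cong (λ c → p + (c + q)) (sym dv₂) ⟩
      p + (occ d v + q)
    ≡⟨ trans (cong (p +_) (sym (occ-++ d v Q))) (sym (occ-++ d P (v ++ Q))) ⟩
      occ d (P ++ v ++ Q)
    ≡⟨ d₂ ⟩
      2
    ∎))
    where open ≡-Reasoning

occ-pair≡1⇔ : ∀ {b p q} → p ≢ q → occ b (p ∷ q ∷ []) ≡ 1 ⇔ (b ≡ p ⊎ b ≡ q)
occ-pair≡1⇔ {b} {p} {q} p≢q with p ≟ b | q ≟ b
... | yes refl | yes refl = ⊥-elim (p≢q refl)
... | yes refl | no q≢b = mk⇔ (λ _ → inj₁ refl) (λ _ → trans (occ-here (q ∷ []) refl) (cong suc (occ-there [] q≢b)))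
... | no p≢b | yes refl = mk⇔ (λ _ → inj₂ refl) (λ _ → trans (occ-there (q ∷ []) p≢b) (occ-here {q} [] refl))
... | no p≢b | no q≢b = mk⇔ (λ b₁ → ⊥-elim (0≢1+n (trans (sym (trans (occ-there (q ∷ []) p≢b) (occ-there [] q≢b))) b₁)))
                            λ { (inj₁ refl) → ⊥-elim (p≢b refl) ; (inj₂ refl) → ⊥-elim (q≢b refl) }

m+n≡2⇒[m≡1⇔n≡1] : ∀ {p q} → p + q ≡ 2 → p ≡ 1 ⇔ q ≡ 1
m+n≡2⇒[m≡1⇔n≡1] {p} {q} sum = mk⇔
  (λ p≡1 → suc-injective (trans (cong (_+ q) (sym p≡1)) sum))
  (λ q≡1 → +-cancelʳ-≡ 1 p 1 (trans (cong (p +_) (sym q≡1)) sum))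

word-of-pair-empty : ∀ {p q} z → All (λ y → y ≡ p ⊎ y ≡ q) z → occ p z ≡ 0 → occ q z ≡ 0 → z ≡ []
word-of-pair-empty [] _ _ _ = refl
word-of-pair-empty (y ∷ z) (inj₁ refl ∷ _) p₀ _ = ⊥-elim (1+n≢0 (trans (sym (occ-here {y} z refl)) p₀))
word-of-pair-empty (y ∷ z) (inj₂ refl ∷ _) _ q₀ = ⊥-elim (1+n≢0 (trans (sym (occ-here {y} z refl)) q₀))

word-of-pair-singleton : ∀ {p q} z → All (λ y → y ≡ p ⊎ y ≡ q) z → occ p z ≡ 0 → occ q z ≡ 1 → z ≡ q ∷ []
word-of-pair-singleton (y ∷ z) (inj₁ refl ∷ _) p₀ _ = ⊥-elim (1+n≢0 (trans (sym (occ-here {y} z refl)) p₀))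
word-of-pair-singleton (y ∷ z) (inj₂ refl ∷ rest) p₀ q₁ = cong (y ∷_)
  (word-of-pair-empty z rest (trans (sym (occ-there z y≢p)) p₀) (suc-injective (trans (sym (occ-here {y} z refl)) q₁)))
  where
  y≢p : y ≢ _
  y≢p y≡p = 1+n≢0 (trans (sym (occ-here z y≡p)) p₀)

word-of-pair : ∀ {p q} z → p ≢ q → All (λ y → y ≡ p ⊎ y ≡ q) z → occ p z ≡ 1 → occ q z ≡ 1 →
  z ≡ p ∷ q ∷ [] ⊎ z ≡ q ∷ p ∷ []
word-of-pair (y ∷ z) p≢q (inj₁ refl ∷ rest) p₁ q₁ = inj₁ (cong (y ∷_)
  (word-of-pair-singleton z rest (suc-injective (trans (sym (occ-here {y} z refl)) p₁)) (trans (sym (occ-there z p≢q)) q₁)))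
word-of-pair (y ∷ z) p≢q (inj₂ refl ∷ rest) p₁ q₁ = inj₂ (cong (y ∷_)
  (word-of-pair-singleton z (All.map swap rest) (suc-injective (trans (sym (occ-here {y} z refl)) q₁))
    (trans (sym (occ-there z (≢-sym p≢q))) p₁)))

occSum : Word → ℕ → ℕ
occSum w zero = 0
occSum w (suc K) = occ (suc K) w + occSum w K

occSum-[] : ∀ K → occSum [] K ≡ 0
occSum-[] zero = refl
occSum-[] (suc K) = occSum-[] K

occSum-∷-beyond : ∀ x w K → K < x → occSum (x ∷ w) K ≡ occSum w K
occSum-∷-beyond x w zero _ = refl
occSum-∷-beyond x w (suc K) K<x =
  cong₂ _+_ (occ-there w (λ x≡K → <-irrefl (sym x≡K) K<x)) (occSum-∷-beyond x w K (≤-trans (n≤1+n _) K<x))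

occSum-∷-within : ∀ x w K → 1 ≤ x → x ≤ K → occSum (x ∷ w) K ≡ suc (occSum w K)
occSum-∷-within .0 w zero () z≤n
occSum-∷-within x w (suc K) 1≤x x≤K with m≤n⇒m<n∨m≡n x≤K
... | inj₁ x<1+K = trans (cong₂ _+_ (occ-there w (<⇒≢ x<1+K)) (occSum-∷-within x w K 1≤x (≤-pred x<1+K))) (+-suc _ _)
... | inj₂ refl = cong₂ _+_ (occ-here w refl) (occSum-∷-beyond x w K ≤-refl)

length≡occSum : ∀ {n} w → (∀ y → y ∈ w → InAlph n y) → length w ≡ occSum w n
length≡occSum {n} [] _ = sym (occSum-[] n)
length≡occSum {n} (x ∷ w) inAlph = trans (cong suc (length≡occSum w (λ y y∈w → inAlph y (there y∈w))))
  (sym (occSum-∷-within x w n (proj₁ (inAlph x (here refl))) (proj₂ (inAlph x (here refl)))))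

length-uniform : ∀ {r n w} → Uniform r n w → length w ≡ n * r
length-uniform {r} {n} {w} (inAlph , uniform) = trans (length≡occSum w inAlph) (occSum≡ n ≤-refl)
  where
  occSum≡ : ∀ K → K ≤ n → occSum w K ≡ K * r
  occSum≡ zero _ = refl
  occSum≡ (suc K) K<n = cong₂ _+_ (uniform (suc K) (s≤s z≤n , K<n)) (occSum≡ K (<⇒≤ K<n))

ascending : ℕ → Word
ascending zero = []
ascending (suc K) = ascending K ++ [ suc K ]

occ-ascending-beyond : ∀ {b} K → K < b → occ b (ascending K) ≡ 0
occ-ascending-beyond zero _ = refl
occ-ascending-beyond (suc K) K<b = trans (occ-++ _ (ascending K) _)
  (cong₂ _+_ (occ-ascending-beyond K (<-trans (n<1+n K) K<b)) (occ-there [] (<⇒≢ K<b)))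

occ-ascending-within : ∀ {b} K → 1 ≤ b → b ≤ K → occ b (ascending K) ≡ 1
occ-ascending-within zero () z≤n
occ-ascending-within {b} (suc K) 1≤b b≤1+K with m≤n⇒m<n∨m≡n b≤1+K
... | inj₁ b<1+K = trans (occ-++ b (ascending K) _)
  (cong₂ _+_ (occ-ascending-within K 1≤b (≤-pred b<1+K)) (occ-there [] (≢-sym (<⇒≢ b<1+K))))
... | inj₂ refl = trans (occ-++ b (ascending K) _) (cong₂ _+_ (occ-ascending-beyond K ≤-refl) (occ-here {b} [] refl))

occ-singleton-⇔ : ∀ {x b y c} → (x ≡ b ⇔ y ≡ c) → occ b [ x ] ≡ occ c [ y ]
occ-singleton-⇔ {x} {b} {y} {c} x≡b⇔y≡c with x ≟ b | y ≟ c
... | yes x≡b | yes y≡c = trans (occ-here [] x≡b) (sym (occ-here [] y≡c))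
... | yes x≡b | no y≢c = ⊥-elim (y≢c (Equivalence.to x≡b⇔y≡c x≡b))
... | no x≢b | yes y≡c = ⊥-elim (x≢b (Equivalence.from x≡b⇔y≡c y≡c))
... | no x≢b | no y≢c = trans (occ-there [] x≢b) (sym (occ-there [] y≢c))

-- Residual words and alternation

residual-++ : ∀ xs ys a b → residual (xs ++ ys) a b ≡ residual xs a b ++ residual ys a b
residual-++ xs ys a b = filter-++ (λ x → (x ≟ a) ⊎-dec (x ≟ b)) xs ys

residual-head : ∀ a b xs → residual (a ∷ xs) a b ≡ a ∷ residual xs a b
residual-head a b xs = filter-accept (λ x → (x ≟ a) ⊎-dec (x ≟ b)) (inj₁ refl)

residual-free : ∀ a b z → occ a z ≡ 0 → residual z a b ≡ replicate (occ b z) b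
residual-free a b [] _ = refl
residual-free a b (x ∷ z) eq with x ≟ a
... | yes refl = ⊥-elim (1+n≢0 (trans (sym (occ-here {a} z refl)) eq))
... | no x≢a with x ≟ b
...   | yes refl = trans (filter-accept (λ y → (y ≟ a) ⊎-dec (y ≟ b)) (inj₂ refl))
                     (trans (cong (x ∷_) (residual-free a b z (trans (sym (occ-there z x≢a)) eq)))
                       (cong (λ k → replicate k x) (sym (occ-here z refl))))
...   | no x≢b = trans (filter-reject (λ y → (y ≟ a) ⊎-dec (y ≟ b)) λ { (inj₁ p) → x≢a p ; (inj₂ p) → x≢b p })
                     (trans (residual-free a b z (trans (sym (occ-there z x≢a)) eq))
                       (cong (λ k → replicate k b) (sym (occ-there z x≢b))))

residual-split : ∀ a b u m x → occ a u ≡ 0 → occ a m ≡ 0 → occ a x ≡ 0 →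
  residual (u ++ a ∷ m ++ a ∷ x) a b ≡
    replicate (occ b u) b ++ a ∷ replicate (occ b m) b ++ a ∷ replicate (occ b x) b
residual-split a b u m x u₀ m₀ x₀ = begin
    residual (u ++ a ∷ m ++ a ∷ x) a b
  ≡⟨ residual-++ u _ a b ⟩
    residual u a b ++ residual (a ∷ m ++ a ∷ x) a b
  ≡⟨ cong (residual u a b ++_) (residual-head a b _) ⟩
    residual u a b ++ a ∷ residual (m ++ a ∷ x) a b
  ≡⟨ cong (λ r → residual u a b ++ a ∷ r) (residual-++ m _ a b) ⟩
    residual u a b ++ a ∷ residual m a b ++ residual (a ∷ x) a b
  ≡⟨ cong (λ r → residual u a b ++ a ∷ residual m a b ++ r) (residual-head a b x) ⟩
    residual u a b ++ a ∷ residual m a b ++ a ∷ residual x a b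
  ≡⟨ cong₂ (λ r s → r ++ a ∷ s ++ a ∷ residual x a b) (residual-free a b u u₀) (residual-free a b m m₀) ⟩
    replicate (occ b u) b ++ a ∷ replicate (occ b m) b ++ a ∷ residual x a b
  ≡⟨ cong (λ r → replicate (occ b u) b ++ a ∷ replicate (occ b m) b ++ a ∷ r) (residual-free a b x x₀) ⟩
    replicate (occ b u) b ++ a ∷ replicate (occ b m) b ++ a ∷ replicate (occ b x) b
  ∎
  where open ≡-Reasoning

NoConsecEq-++⁻ʳ : ∀ xs ys → NoConsecEq (xs ++ ys) → NoConsecEq ys
NoConsecEq-++⁻ʳ [] ys p = p
NoConsecEq-++⁻ʳ (x ∷ []) [] p = tt
NoConsecEq-++⁻ʳ (x ∷ []) (y ∷ ys) (_ , p) = p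
NoConsecEq-++⁻ʳ (x ∷ x′ ∷ xs) ys (_ , p) = NoConsecEq-++⁻ʳ (x′ ∷ xs) ys p

NoConsecEq-aba : ∀ {a b} i j l → a ≢ b → i + (j + l) ≡ 2 →
  NoConsecEq (replicate i b ++ a ∷ replicate j b ++ a ∷ replicate l b) ⇔ j ≡ 1
NoConsecEq-aba {a} {b} i j l a≢b total = mk⇔ (λ p → between j (NoConsecEq-++⁻ʳ (replicate i b) _ p)) (around i j l total)
  where
  between : ∀ j {r} → NoConsecEq (a ∷ replicate j b ++ a ∷ r) → j ≡ 1
  between zero (a≢a , _) = ⊥-elim (a≢a refl)
  between (suc zero) _ = refl
  between (suc (suc j)) (_ , b≢b , _) = ⊥-elim (b≢b refl)
  around : ∀ i j l → i + (j + l) ≡ 2 → j ≡ 1 →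
    NoConsecEq (replicate i b ++ a ∷ replicate j b ++ a ∷ replicate l b)
  around zero _ (suc zero) _ refl = a≢b , ≢-sym a≢b , a≢b , tt
  around (suc zero) _ zero _ refl = ≢-sym a≢b , a≢b , ≢-sym a≢b , tt
  around zero _ zero () refl
  around zero _ (suc (suc l)) () refl
  around (suc zero) _ (suc l) () refl
  around (suc (suc i)) _ l eq refl = ⊥-elim (m+1+n≢0 i (suc-injective (suc-injective eq)))

alternate⇔occ≡1 : ∀ {a b} u m x → a ≢ b → occ a u ≡ 0 → occ a m ≡ 0 → occ a x ≡ 0 →
  occ b (u ++ a ∷ m ++ a ∷ x) ≡ 2 → Alternate (u ++ a ∷ m ++ a ∷ x) a b ⇔ occ b m ≡ 1
alternate⇔occ≡1 {a} {b} u m x a≢b u₀ m₀ x₀ b₂ = mk⇔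
  (λ (_ , _ , p) → Equivalence.to shape (subst NoConsecEq res p))
  (λ m₁ → a∈w , b∈w , subst NoConsecEq (sym res) (Equivalence.from shape m₁))
  where
  res : residual (u ++ a ∷ m ++ a ∷ x) a b ≡ replicate (occ b u) b ++ a ∷ replicate (occ b m) b ++ a ∷ replicate (occ b x) b
  res = residual-split a b u m x u₀ m₀ x₀
  shape : NoConsecEq (replicate (occ b u) b ++ a ∷ replicate (occ b m) b ++ a ∷ replicate (occ b x) b) ⇔ occ b m ≡ 1
  shape = NoConsecEq-aba (occ b u) (occ b m) (occ b x) a≢b (trans (sym (occ-split u m x a≢b)) b₂)
  a∈w : a ∈ u ++ a ∷ m ++ a ∷ x
  a∈w = ∈-++⁺ʳ u (here refl)
  b∈w : b ∈ u ++ a ∷ m ++ a ∷ x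
  b∈w = occ>0⇒∈ _ (subst (0 <_) (sym b₂) (s≤s z≤n))

alternate⇔between-pair : ∀ {a b p q} x → a ≢ b → p ≢ q → p ≢ a → q ≢ a → occ a x ≡ 0 →
  occ b (a ∷ p ∷ q ∷ a ∷ x) ≡ 2 → Alternate (a ∷ p ∷ q ∷ a ∷ x) a b ⇔ (b ≡ p ⊎ b ≡ q)
alternate⇔between-pair {a} {p = p} {q} x a≢b p≢q p≢a q≢a x₀ b₂ =
  occ-pair≡1⇔ p≢q ⇔-∘ alternate⇔occ≡1 [] (p ∷ q ∷ []) x a≢b refl (trans (occ-there _ p≢a) (occ-there [] q≢a)) x₀ b₂

alternate-inside : ∀ P v Q {d e} → d ≢ e → occ d (P ++ v ++ Q) ≡ 2 → occ e (P ++ v ++ Q) ≡ 2 →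
  occ d v ≡ 2 → Alternate (P ++ v ++ Q) d e → 0 < occ e v
alternate-inside P v Q {d} {e} d≢e d₂ e₂ dv₂ alt with occ-outside P v Q d₂ dv₂ | occ≡2⇒split d v dv₂
... | P₀ , Q₀ | v₁ , v₂ , v₃ , refl , o₁ , o₂ , o₃ =
  subst (0 <_) (sym (occ-split v₁ v₂ v₃ d≢e))
    (≤-trans (≤-reflexive (sym e-between)) (≤-trans (m≤m+n _ (occ e v₃)) (m≤n+m _ (occ e v₁))))
  where
  regroup : P ++ (v₁ ++ d ∷ v₂ ++ d ∷ v₃) ++ Q ≡ (P ++ v₁) ++ d ∷ v₂ ++ d ∷ (v₃ ++ Q)
  regroup = begin
      P ++ (v₁ ++ d ∷ v₂ ++ d ∷ v₃) ++ Q
    ≡⟨ cong (P ++_) (++-assoc v₁ (d ∷ v₂ ++ d ∷ v₃) Q) ⟩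
      P ++ v₁ ++ d ∷ (v₂ ++ d ∷ v₃) ++ Q
    ≡⟨ cong (λ r → P ++ v₁ ++ d ∷ r) (++-assoc v₂ (d ∷ v₃) Q) ⟩
      P ++ v₁ ++ d ∷ v₂ ++ d ∷ v₃ ++ Q
    ≡⟨ sym (++-assoc P v₁ _) ⟩
      (P ++ v₁) ++ d ∷ v₂ ++ d ∷ (v₃ ++ Q)
    ∎
    where open ≡-Reasoning
  e-between : occ e v₂ ≡ 1
  e-between = Equivalence.to
    (alternate⇔occ≡1 (P ++ v₁) v₂ (v₃ ++ Q) d≢e
      (trans (occ-++ d P v₁) (cong₂ _+_ P₀ o₁)) o₂
      (trans (occ-++ d v₃ Q) (cong₂ _+_ o₃ Q₀))
      (trans (cong (occ e) (sym regroup)) e₂))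
    (subst (λ w → Alternate w d e) regroup alt)

¬alternate-self : ∀ a w → occ a w ≡ 2 → ¬ Alternate w a a
¬alternate-self a w a₂ (_ , _ , p) with occ≡2⇒split a w a₂
... | u , m , x , refl , u₀ , m₀ , x₀ with residual-split a a u m x u₀ m₀ x₀
... | res rewrite u₀ | m₀ = proj₁ (subst NoConsecEq res p) refl

alternate-sym : ∀ w a b → Alternate w a b → Alternate w b a
alternate-sym w a b (a∈w , b∈w , p) = b∈w , a∈w , subst NoConsecEq (filter-≐ _ _ (swap , swap) w) p

alternate-sym⇔ : ∀ w a b → Alternate w a b ⇔ Alternate w b a
alternate-sym⇔ w a b = mk⇔ (alternate-sym w a b) (alternate-sym w b a)

-- Rotations and reversal

rot₁ : Word → Word
rot₁ [] = []
rot₁ (x ∷ t) = t ++ [ x ]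

occ-rot₁ : ∀ a w → occ a (rot₁ w) ≡ occ a w
occ-rot₁ a [] = refl
occ-rot₁ a (x ∷ t) = occ-↭ a (↭-sym (∷↭∷ʳ x t))

length-rot₁ : ∀ w → length (rot₁ w) ≡ length w
length-rot₁ [] = refl
length-rot₁ (x ∷ t) = trans (length-++ t) (+-comm (length t) 1)

alternate-rot₁-head : ∀ {a b} t → a ≢ b → occ a (a ∷ t) ≡ 2 → occ b (a ∷ t) ≡ 2 →
  Alternate (a ∷ t) a b ⇔ Alternate (t ++ [ a ]) a b
alternate-rot₁-head {a} {b} t a≢b a₂ b₂ with occ≡1⇒split a t (suc-injective (trans (sym (occ-here {a} t refl)) a₂))
... | v , x , refl , v₀ , x₀ =
  subst (λ w → Alternate (a ∷ v ++ a ∷ x) a b ⇔ Alternate w a b) (sym (++-assoc v (a ∷ x) [ a ]))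
    (⇔-sym after ⇔-∘ (m+n≡2⇒[m≡1⇔n≡1] sum ⇔-∘ before))
  where
  sum : occ b v + occ b x ≡ 2
  sum = trans (sym (occ-split [] v x a≢b)) b₂
  before : Alternate (a ∷ v ++ a ∷ x) a b ⇔ occ b v ≡ 1
  before = alternate⇔occ≡1 [] v x a≢b refl v₀ x₀ b₂
  after : Alternate (v ++ a ∷ x ++ a ∷ []) a b ⇔ occ b x ≡ 1
  after = alternate⇔occ≡1 v x [] a≢b v₀ x₀ refl
    (trans (occ-split v x [] a≢b) (trans (cong (occ b v +_) (+-identityʳ _)) sum))

alternate-rot₁ : ∀ a b w → occ a w ≡ 2 → occ b w ≡ 2 → Alternate w a b ⇔ Alternate (rot₁ w) a b
alternate-rot₁ a b (y ∷ t) a₂ b₂ with a ≟ b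
... | yes refl = mk⇔ (λ p → ⊥-elim (¬alternate-self a _ a₂ p))
                     (λ p → ⊥-elim (¬alternate-self a _ (trans (occ-rot₁ a (y ∷ t)) a₂) p))
... | no a≢b with y ≟ a | y ≟ b
...   | yes refl | _ = alternate-rot₁-head t a≢b a₂ b₂
...   | no _ | yes refl = alternate-sym⇔ _ b a ⇔-∘ (alternate-rot₁-head t (≢-sym a≢b) b₂ a₂ ⇔-∘ alternate-sym⇔ _ a b)
...   | no y≢a | no y≢b = mk⇔
  (λ (a∈w , b∈w , p) → ∈-resp-occ (sym (occ-rot₁ a (y ∷ t))) a∈w , ∈-resp-occ (sym (occ-rot₁ b (y ∷ t))) b∈w
                         , subst NoConsecEq (sym same) p)
  (λ (a∈w , b∈w , p) → ∈-resp-occ (occ-rot₁ a (y ∷ t)) a∈w , ∈-resp-occ (occ-rot₁ b (y ∷ t)) b∈w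
                         , subst NoConsecEq same p)
  where
  P? : ∀ x → Dec (x ≡ a ⊎ x ≡ b)
  P? x = (x ≟ a) ⊎-dec (x ≟ b)
  y∉ab : ¬ (y ≡ a ⊎ y ≡ b)
  y∉ab (inj₁ e) = y≢a e
  y∉ab (inj₂ e) = y≢b e
  same : residual (t ++ [ y ]) a b ≡ residual (y ∷ t) a b
  same = trans (residual-++ t [ y ] a b) (trans (cong (residual t a b ++_) (filter-reject P? {xs = []} y∉ab))
           (trans (++-identityʳ _) (sym (filter-reject P? y∉ab))))

reverse-split : ∀ (u m x : Word) a → reverse (u ++ a ∷ m ++ a ∷ x) ≡ reverse x ++ a ∷ reverse m ++ a ∷ reverse u
reverse-split u m x a = begin
    reverse (u ++ a ∷ m ++ a ∷ x)
  ≡⟨ reverse-++ u (a ∷ m ++ a ∷ x) ⟩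
    reverse (a ∷ m ++ a ∷ x) ++ reverse u
  ≡⟨ cong (_++ reverse u) (trans (unfold-reverse a (m ++ a ∷ x)) (cong (_++ [ a ]) (reverse-++ m (a ∷ x)))) ⟩
    ((reverse (a ∷ x) ++ reverse m) ++ [ a ]) ++ reverse u
  ≡⟨ cong (λ r → ((r ++ reverse m) ++ [ a ]) ++ reverse u) (unfold-reverse a x) ⟩
    (((reverse x ++ [ a ]) ++ reverse m) ++ [ a ]) ++ reverse u
  ≡⟨ ++-assoc ((reverse x ++ [ a ]) ++ reverse m) [ a ] (reverse u) ⟩
    ((reverse x ++ [ a ]) ++ reverse m) ++ a ∷ reverse u
  ≡⟨ ++-assoc (reverse x ++ [ a ]) (reverse m) (a ∷ reverse u) ⟩
    (reverse x ++ [ a ]) ++ reverse m ++ a ∷ reverse u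
  ≡⟨ ++-assoc (reverse x) [ a ] (reverse m ++ a ∷ reverse u) ⟩
    reverse x ++ a ∷ reverse m ++ a ∷ reverse u
  ∎
  where open ≡-Reasoning

alternate-reverse : ∀ a b w → occ a w ≡ 2 → occ b w ≡ 2 → Alternate w a b ⇔ Alternate (reverse w) a b
alternate-reverse a b w a₂ b₂ with a ≟ b
... | yes refl = mk⇔ (λ p → ⊥-elim (¬alternate-self a _ a₂ p))
                     (λ p → ⊥-elim (¬alternate-self a _ (trans (occ-reverse a w) a₂) p))
... | no a≢b with occ≡2⇒split a w a₂
...   | u , m , x , refl , u₀ , m₀ , x₀ =
  subst (λ w′ → Alternate (u ++ a ∷ m ++ a ∷ x) a b ⇔ Alternate w′ a b) (sym (reverse-split u m x a))
    (⇔-sym after ⇔-∘ (mk⇔ (trans (occ-reverse b m)) (trans (sym (occ-reverse b m))) ⇔-∘ before))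
  where
  before : Alternate (u ++ a ∷ m ++ a ∷ x) a b ⇔ occ b m ≡ 1
  before = alternate⇔occ≡1 u m x a≢b u₀ m₀ x₀ b₂
  after : Alternate (reverse x ++ a ∷ reverse m ++ a ∷ reverse u) a b ⇔ occ b (reverse m) ≡ 1
  after = alternate⇔occ≡1 (reverse x) (reverse m) (reverse u) a≢b
    (trans (occ-reverse a x) x₀) (trans (occ-reverse a m) m₀) (trans (occ-reverse a u) u₀)
    (trans (cong (occ b) (sym (reverse-split u m x a))) (trans (occ-reverse b (u ++ a ∷ m ++ a ∷ x)) b₂))

rot : ℕ → Word → Word
rot zero w = w
rot (suc k) w = rot k (rot₁ w)

rot-+ : ∀ j k w → rot (j + k) w ≡ rot k (rot j w)
rot-+ zero k w = refl
rot-+ (suc j) k w = rot-+ j k (rot₁ w)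

length-rot : ∀ k w → length (rot k w) ≡ length w
length-rot zero w = refl
length-rot (suc k) w = trans (length-rot k (rot₁ w)) (length-rot₁ w)

occ-rot : ∀ a k w → occ a (rot k w) ≡ occ a w
occ-rot a zero w = refl
occ-rot a (suc k) w = trans (occ-rot a k (rot₁ w)) (occ-rot₁ a w)

alternate-rot : ∀ a b k w → occ a w ≡ 2 → occ b w ≡ 2 → Alternate w a b ⇔ Alternate (rot k w) a b
alternate-rot a b zero w _ _ = mk⇔ (λ p → p) (λ p → p)
alternate-rot a b (suc k) w a₂ b₂ =
  alternate-rot a b k (rot₁ w) (trans (occ-rot₁ a w) a₂) (trans (occ-rot₁ b w) b₂) ⇔-∘ alternate-rot₁ a b w a₂ b₂

take-++ˡ : ∀ i (t ys : Word) → i ≤ length t → take i (t ++ ys) ≡ take i t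
take-++ˡ zero t ys _ = refl
take-++ˡ (suc i) (x ∷ t) ys (s≤s i≤t) = cong (x ∷_) (take-++ˡ i t ys i≤t)

drop-++ˡ : ∀ i (t ys : Word) → i ≤ length t → drop i (t ++ ys) ≡ drop i t ++ ys
drop-++ˡ zero t ys _ = refl
drop-++ˡ (suc i) (x ∷ t) ys (s≤s i≤t) = drop-++ˡ i t ys i≤t

rotate≡rot : ∀ i w → i ≤ length w → rotate i w ≡ rot i w
rotate≡rot zero w _ = ++-identityʳ w
rotate≡rot (suc i) (x ∷ t) (s≤s i≤t) = begin
    drop i t ++ x ∷ take i t
  ≡⟨ sym (++-assoc (drop i t) [ x ] (take i t)) ⟩
    (drop i t ++ [ x ]) ++ take i t
  ≡⟨ cong₂ _++_ (sym (drop-++ˡ i t [ x ] i≤t)) (sym (take-++ˡ i t [ x ] i≤t)) ⟩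
    rotate i (t ++ [ x ])
  ≡⟨ rotate≡rot i (t ++ [ x ]) (subst (i ≤_) (sym (length-rot₁ (x ∷ t))) (m≤n⇒m≤1+n i≤t)) ⟩
    rot i (t ++ [ x ])
  ∎
  where open ≡-Reasoning

rot-length : ∀ w → rot (length w) w ≡ w
rot-length w = begin
    rot (length w) w
  ≡⟨ sym (rotate≡rot (length w) w ≤-refl) ⟩
    drop (length w) w ++ take (length w) w
  ≡⟨ cong₂ _++_ (drop-all (length w) w ≤-refl) (take-all (length w) w ≤-refl) ⟩
    w
  ∎
  where open ≡-Reasoning

Valid : ℕ → Word → Set
Valid n w = Uniform 2 n w × Represents n w

valid-transport : ∀ {n w w′} → (∀ a → occ a w′ ≡ occ a w) →
  (∀ a b → occ a w ≡ 2 → occ b w ≡ 2 → Alternate w a b ⇔ Alternate w′ a b) →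
  Valid n w → Valid n w′
valid-transport occ≡ alt⇔ ((inAlph , twice) , rep) =
  ((λ x x∈w′ → inAlph x (∈-resp-occ (occ≡ x) x∈w′)) , (λ a A → trans (occ≡ a) (twice a A))) ,
  (λ a b A B → rep a b A B ⇔-∘ ⇔-sym (alt⇔ a b (twice a A) (twice b B)))

valid-rot₁ : ∀ {n w} → Valid n w → Valid n (rot₁ w)
valid-rot₁ {w = w} = valid-transport (λ a → occ-rot₁ a w) (λ a b → alternate-rot₁ a b w)

valid-reverse : ∀ {n w} → Valid n w → Valid n (reverse w)
valid-reverse {w = w} = valid-transport (λ a → occ-reverse a w) (λ a b → alternate-reverse a b w)

valid-rot : ∀ {n} k {w} → Valid n w → Valid n (rot k w)
valid-rot zero v = v
valid-rot (suc k) v = valid-rot k (valid-rot₁ v)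

-- Reading a word cyclically

-- The letter at position k, with the junk value 0 past the end of the word.
at : Word → ℕ → ℕ
at [] _ = 0
at (x ∷ _) zero = x
at (_ ∷ xs) (suc k) = at xs k

cyc : Word → ℕ → ℕ
cyc w k = at (rot k w) 0

cyc-rot : ∀ w j k → cyc (rot j w) k ≡ cyc w (j + k)
cyc-rot w j k = cong (λ z → at z 0) (sym (rot-+ j k w))

cyc-periodic : ∀ w k → cyc w (length w + k) ≡ cyc w k
cyc-periodic w k = trans (sym (cyc-rot w (length w) k)) (cong (λ z → cyc z k) (rot-length w))

at-++ˡ : ∀ xs ys k → k < length xs → at (xs ++ ys) k ≡ at xs k
at-++ˡ (x ∷ xs) ys zero _ = refl
at-++ˡ (x ∷ xs) ys (suc k) (s≤s k<xs) = at-++ˡ xs ys k k<xs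

at-++ʳ : ∀ xs ys k → at (xs ++ ys) (length xs + k) ≡ at ys k
at-++ʳ [] ys k = refl
at-++ʳ (x ∷ xs) ys k = at-++ʳ xs ys k

at≡cyc : ∀ k w → k < length w → at w k ≡ cyc w k
at≡cyc zero (x ∷ w) _ = refl
at≡cyc (suc k) (x ∷ w) (s≤s k<w) = trans (sym (at-++ˡ w [ x ] k k<w))
  (at≡cyc k (w ++ [ x ]) (subst (k <_) (sym (length-rot₁ (x ∷ w))) (m≤n⇒m≤1+n k<w)))

at-∈ : ∀ xs k → k < length xs → at xs k ∈ xs
at-∈ (x ∷ xs) zero _ = here refl
at-∈ (x ∷ xs) (suc k) (s≤s k<xs) = there (at-∈ xs k k<xs)

at-reverse : ∀ z k → k < length z → at (reverse z) k ≡ at z (length z ∸ suc k)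
at-reverse (x ∷ z) k k<xz rewrite unfold-reverse x z with k <? length z
... | yes k<z = begin
    at (reverse z ++ [ x ]) k
  ≡⟨ at-++ˡ (reverse z) [ x ] k (subst (k <_) (sym (length-reverse z)) k<z) ⟩
    at (reverse z) k
  ≡⟨ at-reverse z k k<z ⟩
    at z (length z ∸ suc k)
  ≡⟨ cong (at (x ∷ z)) (sym (+-∸-assoc 1 k<z)) ⟩
    at (x ∷ z) (suc (length z) ∸ suc k)
  ∎
  where open ≡-Reasoning
... | no k≮z with ≤-antisym (≤-pred k<xz) (≮⇒≥ k≮z)
...   | refl = begin
    at (reverse z ++ [ x ]) (length z)
  ≡⟨ cong (at (reverse z ++ [ x ])) (sym (trans (+-identityʳ _) (length-reverse z))) ⟩
    at (reverse z ++ [ x ]) (length (reverse z) + 0)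
  ≡⟨ at-++ʳ (reverse z) [ x ] 0 ⟩
    x
  ≡⟨ cong (at (x ∷ z)) (sym (n∸n≡0 (length z))) ⟩
    at (x ∷ z) (suc (length z) ∸ suc (length z))
  ∎
  where open ≡-Reasoning

at-ext : ∀ xs ys → length xs ≡ length ys → (∀ k → k < length xs → at xs k ≡ at ys k) → xs ≡ ys
at-ext [] [] _ _ = refl
at-ext (x ∷ xs) (y ∷ ys) eq pointwise =
  cong₂ _∷_ (pointwise 0 (s≤s z≤n)) (at-ext xs ys (suc-injective eq) (λ k k<xs → pointwise (suc k) (s≤s k<xs)))

cyc-ext : ∀ w w′ → length w ≡ length w′ → (∀ k → cyc w k ≡ cyc w′ k) → w ≡ w′
cyc-ext w w′ eq pointwise = at-ext w w′ eq λ k k<w →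
  trans (at≡cyc k w k<w) (trans (pointwise k) (sym (at≡cyc k w′ (subst (k <_) eq k<w))))

first-four : ∀ z → 4 ≤ length z → z ≡ cyc z 0 ∷ cyc z 1 ∷ cyc z 2 ∷ cyc z 3 ∷ drop 4 z
first-four (_ ∷ _ ∷ _ ∷ _ ∷ _) _ = refl
first-four (_ ∷ []) (s≤s ())
first-four (_ ∷ _ ∷ []) (s≤s (s≤s ()))
first-four (_ ∷ _ ∷ _ ∷ []) (s≤s (s≤s (s≤s ())))

-- Second-order recurrences

parity : ∀ d → ∃[ i ] (d ≡ 2 * i ⊎ d ≡ suc (2 * i))
parity zero = 0 , inj₁ refl
parity (suc d) with parity d
... | i , inj₁ refl = i , inj₂ refl
... | i , inj₂ refl = suc i , inj₁ (sym (*-suc 2 i))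

Recurrent : (ℕ → ℕ) → (ℕ → ℕ) → Set
Recurrent F c = ∀ q → c (2 + q) ≡ F (c q)

recurrent-ext : ∀ {F c c′} → Recurrent F c → Recurrent F c′ → c 0 ≡ c′ 0 → c 1 ≡ c′ 1 → ∀ q → c q ≡ c′ q
recurrent-ext {F} {c} {c′} rec rec′ e₀ e₁ q = proj₁ (pairs q)
  where
  pairs : ∀ q → c q ≡ c′ q × c (1 + q) ≡ c′ (1 + q)
  pairs zero = e₀ , e₁
  pairs (suc q) = let (e , e′) = pairs q in e′ , trans (rec q) (trans (cong F e) (sym (rec′ q)))

recurrent-rot : ∀ {F} w j → Recurrent F (cyc w) → Recurrent F (cyc (rot j w))
recurrent-rot {F} w j rec q = begin
    cyc (rot j w) (2 + q)
  ≡⟨ cyc-rot w j (2 + q) ⟩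
    cyc w (j + (2 + q))
  ≡⟨ cong (cyc w) (x∙yz≈y∙xz j 2 q) ⟩
    cyc w (2 + (j + q))
  ≡⟨ rec (j + q) ⟩
    F (cyc w (j + q))
  ≡⟨ cong F (sym (cyc-rot w j q)) ⟩
    F (cyc (rot j w) q)
  ∎
  where open ≡-Reasoning

recurrent-periodic : ∀ {m} (F c : ℕ → ℕ) → 0 < m → (∀ q → c (m + q) ≡ c q) →
  (∀ q → q < m → c (2 + q) ≡ F (c q)) → Recurrent F c
recurrent-periodic {m} F c 0<m periodic below = <-rec _ step
  where
  step : ∀ q → (∀ {r} → r < q → c (2 + r) ≡ F (c r)) → c (2 + q) ≡ F (c q)
  step q ih with q <? m
  ... | yes q<m = below q q<m
  ... | no q≮m with m≤n⇒∃[o]m+o≡n (≮⇒≥ q≮m)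
  ...   | r , refl = begin
      c (2 + (m + r))
    ≡⟨ cong c (sym (x∙yz≈y∙xz m 2 r)) ⟩
      c (m + (2 + r))
    ≡⟨ periodic (2 + r) ⟩
      c (2 + r)
    ≡⟨ ih (m<n+m r 0<m) ⟩
      F (c r)
    ≡⟨ cong F (sym (periodic r)) ⟩
      F (c (m + r))
    ∎
    where open ≡-Reasoning

recurrent-both-ways : ∀ F z → 3 ≤ length z → Recurrent F (cyc z) → Recurrent F (cyc (reverse z)) →
  ∃[ x ] x ∈ z × F (F x) ≡ x
recurrent-both-ways F z 3≤L rec rec′ = at z i , at-∈ z i i<L , sym (begin
    at z i
  ≡⟨ sym (at-reverse z 2 2<L) ⟩
    at (reverse z) 2
  ≡⟨ at≡cyc 2 (reverse z) (subst (2 <_) (sym (length-reverse z)) 2<L) ⟩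
    cyc (reverse z) 2
  ≡⟨ rec′ 0 ⟩
    F (cyc (reverse z) 0)
  ≡⟨ cong F (sym (at≡cyc 0 (reverse z) (subst (0 <_) (sym (length-reverse z)) 0<L))) ⟩
    F (at (reverse z) 0)
  ≡⟨ cong F (trans (at-reverse z 0 0<L) (cong (λ l → at z (l ∸ 1)) (sym 3+i≡L))) ⟩
    F (at z (2 + i))
  ≡⟨ cong F (at≡cyc (2 + i) z 2+i<L) ⟩
    F (cyc z (2 + i))
  ≡⟨ cong F (rec i) ⟩
    F (F (cyc z i))
  ≡⟨ cong (F ∘ F) (sym (at≡cyc i z i<L)) ⟩
    F (F (at z i))
  ∎)
  where
  open ≡-Reasoning
  L : ℕ
  L = length z
  i : ℕ
  i = L ∸ 3
  3+i≡L : 3 + i ≡ L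
  3+i≡L = m+[n∸m]≡n 3≤L
  2+i<L : 2 + i < L
  2+i<L = ≤-reflexive 3+i≡L
  i<L : i < L
  i<L = ≤-trans (s≤s (m≤n+m i 2)) 2+i<L
  0<L : 0 < L
  0<L = ≤-trans (s≤s z≤n) 3≤L
  2<L : 2 < L
  2<L = 3≤L

module CyclicOrder (n : ℕ) where

  Letter : ℕ → Set
  Letter = InAlph n

  next : ℕ → ℕ
  next a = if a <ᵇ n then suc a else 1

  prev : ℕ → ℕ
  prev a = if 1 <ᵇ a then pred a else n

  next-< : ∀ {a} → a < n → next a ≡ suc a
  next-< {a} a<n with a <ᵇ n | <⇒<ᵇ a<n
  ... | true | _ = refl

  next-n : next n ≡ 1
  next-n with n <ᵇ n | <ᵇ⇒< n n
  ... | false | _ = refl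
  ... | true | n<n = ⊥-elim (<-irrefl refl (n<n _))

  prev-> : ∀ {a} → 1 < a → prev a ≡ pred a
  prev-> {a} 1<a with 1 <ᵇ a | <⇒<ᵇ 1<a
  ... | true | _ = refl

  next-letter : ∀ {a} → Letter a → Letter (next a)
  next-letter {a} (1≤a , a≤n) with m≤n⇒m<n∨m≡n a≤n
  ... | inj₁ a<n rewrite next-< a<n = s≤s z≤n , a<n
  ... | inj₂ refl rewrite next-n = ≤-refl , 1≤a

  prev-letter : ∀ {a} → Letter a → Letter (prev a)
  prev-letter {suc zero} (_ , 1≤n) = 1≤n , ≤-refl
  prev-letter {suc (suc a)} (_ , a<n) = s≤s z≤n , ≤-trans (n≤1+n _) a<n

  prev-next : ∀ {a} → Letter a → prev (next a) ≡ a
  prev-next {a} (1≤a , a≤n) with m≤n⇒m<n∨m≡n a≤n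
  ... | inj₁ a<n rewrite next-< a<n = prev-> (s≤s 1≤a)
  ... | inj₂ refl rewrite next-n = refl

  next-prev : ∀ {a} → Letter a → next (prev a) ≡ a
  next-prev {suc zero} _ = next-n
  next-prev {suc (suc a)} (_ , a<n) = next-< a<n

  adjacent-next : ∀ {a} → a ≤ n → CycleAdj n a (next a)
  adjacent-next a≤n with m≤n⇒m<n∨m≡n a≤n
  ... | inj₁ a<n = inj₁ (next-< a<n)
  ... | inj₂ refl = inj₂ (inj₂ (inj₂ (refl , next-n)))

  adjacent-prev : ∀ {a} → 1 ≤ a → CycleAdj n a (prev a)
  adjacent-prev {suc zero} _ = inj₂ (inj₂ (inj₁ (refl , refl)))
  adjacent-prev {suc (suc a)} _ = inj₂ (inj₁ refl)

  adjacent⇔ : ∀ {a b} → Letter a → Letter b → CycleAdj n a b ⇔ (b ≡ next a ⊎ b ≡ prev a)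
  adjacent⇔ {a} {b} (1≤a , a≤n) (1≤b , b≤n) = mk⇔ to from
    where
    to : CycleAdj n a b → b ≡ next a ⊎ b ≡ prev a
    to (inj₁ refl) = inj₁ (sym (next-< b≤n))
    to (inj₂ (inj₁ refl)) = inj₂ (sym (prev-> (s≤s 1≤b)))
    to (inj₂ (inj₂ (inj₁ (refl , refl)))) = inj₂ refl
    to (inj₂ (inj₂ (inj₂ (refl , refl)))) = inj₁ (sym next-n)
    from : b ≡ next a ⊎ b ≡ prev a → CycleAdj n a b
    from (inj₁ refl) = adjacent-next a≤n
    from (inj₂ refl) = adjacent-prev 1≤a

  next^-letter : ∀ t {a} → Letter a → Letter ((next ^ t) a)
  next^-letter zero A = A
  next^-letter (suc t) A = next-letter (next^-letter t A)

  next^-+ : ∀ s t a → (next ^ (s + t)) a ≡ (next ^ s) ((next ^ t) a)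
  next^-+ s t = cong-app (^-homo next s t)

  next^-≤ : ∀ t {a} → a + t ≤ n → (next ^ t) a ≡ a + t
  next^-≤ zero {a} _ = sym (+-identityʳ a)
  next^-≤ (suc t) {a} a+1+t≤n = begin
      next ((next ^ t) a)
    ≡⟨ cong next (next^-≤ t (≤-trans (+-monoʳ-≤ a (n≤1+n t)) a+1+t≤n)) ⟩
      next (a + t)
    ≡⟨ next-< (subst (_≤ n) (+-suc a t) a+1+t≤n) ⟩
      suc (a + t)
    ≡⟨ sym (+-suc a t) ⟩
      a + suc t
    ∎
    where open ≡-Reasoning

  next^-wrap : ∀ r {a} → Letter a → suc r ≤ n → (next ^ (r + suc (n ∸ a))) a ≡ suc r
  next^-wrap r {a} (_ , a≤n) r<n = begin
      (next ^ (r + suc (n ∸ a))) a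
    ≡⟨ next^-+ r (suc (n ∸ a)) a ⟩
      (next ^ r) (next ((next ^ (n ∸ a)) a))
    ≡⟨ cong (λ x → (next ^ r) (next x)) (next^-≤ (n ∸ a) (≤-reflexive a+[n∸a]≡n)) ⟩
      (next ^ r) (next (a + (n ∸ a)))
    ≡⟨ cong (λ x → (next ^ r) (next x)) a+[n∸a]≡n ⟩
      (next ^ r) (next n)
    ≡⟨ cong (next ^ r) next-n ⟩
      (next ^ r) 1
    ≡⟨ next^-≤ r r<n ⟩
      suc r
    ∎
    where
    open ≡-Reasoning
    a+[n∸a]≡n : a + (n ∸ a) ≡ n
    a+[n∸a]≡n = m+[n∸m]≡n a≤n

  next^-full : ∀ {a} → Letter a → (next ^ n) a ≡ a
  next^-full {suc r} A@(_ , a≤n) = subst (λ t → (next ^ t) (suc r) ≡ suc r) turn (next^-wrap r A a≤n)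
    where
    turn : r + suc (n ∸ suc r) ≡ n
    turn = trans (+-suc r _) (m+[n∸m]≡n a≤n)

  next^-cancel : ∀ t {a b} → Letter a → Letter b → (next ^ t) a ≡ (next ^ t) b → a ≡ b
  next^-cancel zero _ _ eq = eq
  next^-cancel (suc t) A B eq = next^-cancel t A B
    (trans (sym (prev-next (next^-letter t A))) (trans (cong prev eq) (prev-next (next^-letter t B))))

  next^-fixed : ∀ {d a} → Letter a → d < n → (next ^ d) a ≡ a → d ≡ 0
  next^-fixed {d} {a} A@(_ , a≤n) d<n fixed with a + d ≤? n
  ... | yes a+d≤n = +-cancelˡ-≡ a d 0 (trans (sym (next^-≤ d a+d≤n)) (trans fixed (sym (+-identityʳ a))))
  ... | no a+d≰n = ⊥-elim (<-irrefl d≡n d<n)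
    where
    r : ℕ
    r = d ∸ suc (n ∸ a)
    n∸a<d : n ∸ a < d
    n∸a<d = subst (n ∸ a <_) (m+n∸m≡n a d) (∸-monoˡ-< (≰⇒> a+d≰n) a≤n)
    split : r + suc (n ∸ a) ≡ d
    split = m∸n+n≡m n∸a<d
    r+1≡a : suc r ≡ a
    r+1≡a = trans (sym (next^-wrap r A (≤-<-trans (m∸n≤m d (suc (n ∸ a))) d<n)))
              (trans (cong (λ t → (next ^ t) a) split) fixed)
    d≡n : d ≡ n
    d≡n = trans (sym split) (trans (+-suc r _) (trans (cong (_+ (n ∸ a)) r+1≡a) (m+[n∸m]≡n a≤n)))

  next^-injective-≤ : ∀ {a t t′} → Letter a → t ≤ t′ → t′ < n → (next ^ t) a ≡ (next ^ t′) a → t ≡ t′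
  next^-injective-≤ {a} {t} A t≤t′ t′<n eq with m≤n⇒∃[o]m+o≡n t≤t′
  ... | d , refl = sym (trans (cong (t +_) d≡0) (+-identityʳ t))
    where
    d≡0 : d ≡ 0
    d≡0 = next^-fixed A (≤-<-trans (m≤n+m d t) t′<n)
      (sym (next^-cancel t A (next^-letter d A) (trans eq (next^-+ t d a))))

  next^-injective : ∀ {a t t′} → Letter a → t < n → t′ < n → (next ^ t) a ≡ (next ^ t′) a → t ≡ t′
  next^-injective A t<n t′<n eq with ≤-total _ _
  ... | inj₁ t≤t′ = next^-injective-≤ A t≤t′ t′<n eq
  ... | inj₂ t′≤t = sym (next^-injective-≤ A t′≤t t<n (sym eq))

  next^-surjective : ∀ {a b} → Letter a → Letter b → ∃[ t ] t < n × (next ^ t) a ≡ b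
  next^-surjective {suc a} {suc b} A@(_ , a<n) (_ , b<n) with suc a ≤? suc b
  ... | yes a≤b = b ∸ a , ≤-<-trans (m∸n≤m b a) b<n , trans (next^-≤ (b ∸ a) (subst (_≤ n) (sym reach) b<n)) reach
    where
    reach : suc a + (b ∸ a) ≡ suc b
    reach = cong suc (m+[n∸m]≡n (≤-pred a≤b))
  ... | no a≰b = b + suc (n ∸ suc a) , around , next^-wrap b A b<n
    where
    around : b + suc (n ∸ suc a) < n
    around = subst₂ _<_ (sym (+-suc b _)) (m+[n∸m]≡n a<n) (+-monoˡ-< (n ∸ suc a) (≰⇒> a≰b))

  next^-prev : ∀ {t a} → suc t ≡ n → Letter a → (next ^ t) a ≡ prev a
  next^-prev {t} {a} refl A = trans (sym (prev-next (next^-letter t A))) (cong prev (next^-full A))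

module Cycle (k : ℕ) where

  n : ℕ
  n = 4 + k

  open CyclicOrder n public

  next^-≢ : ∀ {a} t t′ → Letter a → t < n → t′ < n → t ≢ t′ → (next ^ t) a ≢ (next ^ t′) a
  next^-≢ t t′ A t<n t′<n t≢t′ eq = t≢t′ (next^-injective A t<n t′<n eq)

  prev≡next^ : ∀ {a} → Letter a → prev a ≡ (next ^ (3 + k)) a
  prev≡next^ A = sym (next^-prev refl A)

  prev²≡next^ : ∀ {a} → Letter a → prev (prev a) ≡ (next ^ (2 + k)) a
  prev²≡next^ A = trans (cong prev (prev≡next^ A)) (prev-next (next^-letter (2 + k) A))

  0<n : 0 < n
  0<n = s≤s z≤n

  1<n : 1 < n
  1<n = s≤s (s≤s z≤n)

  2<n : 2 < n
  2<n = s≤s (s≤s (s≤s z≤n))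

  2+k<n : 2 + k < n
  2+k<n = n≤1+n _

  3+k<n : 3 + k < n
  3+k<n = ≤-refl

  8≤2n : 8 ≤ 2 * n
  8≤2n = s≤s (s≤s (s≤s (s≤s (≤-trans (s≤s (s≤s (s≤s (s≤s z≤n)))) (m≤n+m _ k)))))

  -- Each of these says next^t a ≢ next^t′ a for distinct t, t′ < n; this is where 3 < n is used.
  next≢self : ∀ {a} → Letter a → next a ≢ a
  next≢self A = next^-≢ 1 0 A 1<n 0<n (λ ())

  prev≢self : ∀ {a} → Letter a → prev a ≢ a
  prev≢self A e = next^-≢ (3 + k) 0 A 3+k<n 0<n (λ ()) (trans (sym (prev≡next^ A)) e)

  next≢prev : ∀ {a} → Letter a → next a ≢ prev a
  next≢prev A e = next^-≢ 1 (3 + k) A 1<n 3+k<n (λ ()) (trans e (prev≡next^ A))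

  next²≢self : ∀ {a} → Letter a → next (next a) ≢ a
  next²≢self A = next^-≢ 2 0 A 2<n 0<n (λ ())

  prev²≢self : ∀ {a} → Letter a → prev (prev a) ≢ a
  prev²≢self A e = next^-≢ (2 + k) 0 A 2+k<n 0<n (λ ()) (trans (sym (prev²≡next^ A)) e)

  next²≢prev : ∀ {a} → Letter a → next (next a) ≢ prev a
  next²≢prev A e = next^-≢ 2 (3 + k) A 2<n 3+k<n (λ ()) (trans e (prev≡next^ A))

  next≢prev² : ∀ {a} → Letter a → next a ≢ prev (prev a)
  next≢prev² A e = next^-≢ 1 (2 + k) A 1<n 2+k<n (λ ()) (trans e (prev²≡next^ A))

  Distant : ℕ → ℕ → Set
  Distant a b = b ≢ a × b ≢ next a × b ≢ prev a

  relative-to : ∀ a y → y ≡ a ⊎ (y ≡ prev a ⊎ y ≡ next a) ⊎ Distant a y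
  relative-to a y with y ≟ a | y ≟ prev a | y ≟ next a
  ... | yes y≡a | _ | _ = inj₁ y≡a
  ... | no _ | yes y≡p | _ = inj₂ (inj₁ (inj₁ y≡p))
  ... | no _ | no _ | yes y≡s = inj₂ (inj₁ (inj₂ y≡s))
  ... | no y≢a | no y≢p | no y≢s = inj₂ (inj₂ (y≢a , y≢s , y≢p))

  adjacent⇒≢ : ∀ {d e} → Letter d → e ≡ next d ⊎ e ≡ prev d → d ≢ e
  adjacent⇒≢ D (inj₁ e≡s) d≡e = next≢self D (trans (sym e≡s) (sym d≡e))
  adjacent⇒≢ D (inj₂ e≡p) d≡e = prev≢self D (trans (sym e≡p) (sym d≡e))

  Neighbours : ℕ → Word → Set
  Neighbours a v = v ≡ prev a ∷ next a ∷ [] ⊎ v ≡ next a ∷ prev a ∷ []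

  -- The non-neighbours of a form the path D 0, …, D k in C_n; a letter occurring twice in v forces
  -- each letter alternating with it into v, so along this path the count in v cannot change.
  module Gap {a : ℕ} {v x : Word} (V : Valid n (a ∷ v ++ a ∷ x)) (v₀ : occ a v ≡ 0) (x₀ : occ a x ≡ 0) where

    private
      w : Word
      w = a ∷ v ++ a ∷ x

      letters : ∀ {y} → y ∈ w → Letter y
      letters = proj₁ (proj₁ V) _

      twice : ∀ {b} → Letter b → occ b w ≡ 2
      twice = proj₂ (proj₁ V) _

      A : Letter a
      A = letters (here refl)

      adjacent⇒alternate : ∀ {d e} → Letter d → Letter e → e ≡ next d ⊎ e ≡ prev d → Alternate w d e
      adjacent⇒alternate D E adj = Equivalence.from (proj₂ V _ _ D E) (Equivalence.from (adjacent⇔ D E) adj)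

      occ-v+x : ∀ {b} → Letter b → b ≢ a → occ b v + occ b x ≡ 2
      occ-v+x B b≢a = trans (sym (occ-split [] v x (≢-sym b≢a))) (twice B)

      neighbour⇔once : ∀ {b} → Letter b → b ≢ a → (b ≡ next a ⊎ b ≡ prev a) ⇔ occ b v ≡ 1
      neighbour⇔once B b≢a =
        alternate⇔occ≡1 [] v x (≢-sym b≢a) refl v₀ x₀ (twice B)
          ⇔-∘ (⇔-sym (proj₂ V _ _ A B) ⇔-∘ ⇔-sym (adjacent⇔ A B))

      distant-0-or-2 : ∀ {b} → Letter b → Distant a b → occ b v ≡ 0 ⊎ occ b v ≡ 2
      distant-0-or-2 {b} B (b≢a , b≢s , b≢p) = cases (occ b v) refl
        where
        cases : ∀ c → occ b v ≡ c → occ b v ≡ 0 ⊎ occ b v ≡ 2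
        cases 0 eq = inj₁ eq
        cases 1 eq with Equivalence.from (neighbour⇔once B b≢a) eq
        ... | inj₁ b≡s = ⊥-elim (b≢s b≡s)
        ... | inj₂ b≡p = ⊥-elim (b≢p b≡p)
        cases 2 eq = inj₂ eq
        cases (suc (suc (suc c))) eq = ⊥-elim (≤⇒≯ (≤-trans (≤-reflexive (sym eq))
          (≤-trans (m≤m+n (occ b v) (occ b x)) (≤-reflexive (occ-v+x B b≢a)))) (s≤s (s≤s (s≤s z≤n))))

      spread : ∀ {d e} → Letter d → Letter e → Distant a e → e ≡ next d ⊎ e ≡ prev d →
        occ d v ≡ 2 → occ e v ≡ 2
      spread {d} {e} D E e-far adj d₂ with distant-0-or-2 E e-far
      ... | inj₂ e₂ = e₂
      ... | inj₁ e₀ = ⊥-elim (<⇒≢ (alternate-inside [ a ] v (a ∷ x) (adjacent⇒≢ D adj) (twice D) (twice E) d₂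
                                      (adjacent⇒alternate D E adj)) (sym e₀))

      D : ℕ → ℕ
      D i = (next ^ (2 + i)) a

      D-letter : ∀ i → Letter (D i)
      D-letter i = next^-letter (2 + i) A

      D-distant : ∀ {i} → i ≤ k → Distant a (D i)
      D-distant {i} i≤k =
        next^-≢ (2 + i) 0 A 2+i<n 0<n (λ ()) ,
        next^-≢ (2 + i) 1 A 2+i<n 1<n (λ ()) ,
        λ e → next^-≢ (2 + i) (3 + k) A 2+i<n 3+k<n 2+i≢3+k (trans e (prev≡next^ A))
        where
        2+i<n : 2 + i < n
        2+i<n = s≤s (s≤s (s≤s (m≤n⇒m≤1+n i≤k)))
        2+i≢3+k : 2 + i ≢ 3 + k
        2+i≢3+k e = 1+n≰n (subst (_≤ k) (suc-injective (suc-injective e)) i≤k)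

      D-step : ∀ {i} → i < k → occ (D i) v ≡ occ (D (suc i)) v
      D-step {i} i<k with distant-0-or-2 (D-letter i) (D-distant (<⇒≤ i<k))
                        | distant-0-or-2 (D-letter (suc i)) (D-distant i<k)
      ... | inj₁ e₀ | inj₁ e₁ = trans e₀ (sym e₁)
      ... | inj₂ e₀ | inj₂ e₁ = trans e₀ (sym e₁)
      ... | inj₁ e₀ | inj₂ e₁ = ⊥-elim (0≢1+n (trans (sym e₀)
        (spread (D-letter (suc i)) (D-letter i) (D-distant (<⇒≤ i<k)) (inj₂ (sym (prev-next (D-letter i)))) e₁)))
      ... | inj₂ e₀ | inj₁ e₁ = ⊥-elim (0≢1+n (trans (sym e₁)
        (spread (D-letter i) (D-letter (suc i)) (D-distant i<k) (inj₁ refl) e₀)))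

      D-constant : ∀ i → i ≤ k → occ (D i) v ≡ occ (D 0) v
      D-constant zero _ = refl
      D-constant (suc i) i<k = trans (sym (D-step i<k)) (D-constant i (<⇒≤ i<k))

      distant⇒D : ∀ {y} → Letter y → Distant a y → ∃[ i ] i ≤ k × D i ≡ y
      distant⇒D Y (y≢a , y≢s , y≢p) with next^-surjective A Y
      ... | 0 , _ , refl = ⊥-elim (y≢a refl)
      ... | 1 , _ , refl = ⊥-elim (y≢s refl)
      ... | suc (suc i) , 2+i<n , refl with m≤n⇒m<n∨m≡n (≤-pred (≤-pred (≤-pred 2+i<n)))
      ...   | inj₁ i<1+k = i , ≤-pred i<1+k , refl
      ...   | inj₂ refl = ⊥-elim (y≢p (sym (prev≡next^ A)))

      distant-occ : ∀ {y} → Letter y → Distant a y → occ y v ≡ occ (D 0) v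
      distant-occ Y far with distant⇒D Y far
      ... | i , i≤k , refl = D-constant i i≤k

      only-neighbours : ∀ z → (∀ {y} → y ∈ z → y ∈ w) → occ a z ≡ 0 →
        (∀ {y} → Letter y → Distant a y → occ y z ≡ 0) → All (λ y → y ≡ prev a ⊎ y ≡ next a) z
      only-neighbours z z⊆w a₀ far₀ = All.tabulate (λ {y} y∈z → pick y∈z (relative-to a y))
        where
        pick : ∀ {y} → y ∈ z → y ≡ a ⊎ (y ≡ prev a ⊎ y ≡ next a) ⊎ Distant a y → y ≡ prev a ⊎ y ≡ next a
        pick y∈z (inj₁ refl) = ⊥-elim (occ≡0⇒∉ a₀ y∈z)
        pick y∈z (inj₂ (inj₁ nb)) = nb
        pick y∈z (inj₂ (inj₂ far)) = ⊥-elim (occ≡0⇒∉ (far₀ (letters (z⊆w y∈z)) far) y∈z)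

      neighbour-once : ∀ {b} → Letter b → b ≡ next a ⊎ b ≡ prev a → occ b v ≡ 1
      neighbour-once B nb = Equivalence.to (neighbour⇔once B (≢-sym (adjacent⇒≢ A nb))) nb

      once-v⇒once-x : ∀ {b} → Letter b → b ≢ a → occ b v ≡ 1 → occ b x ≡ 1
      once-v⇒once-x B b≢a b₁ = suc-injective (trans (cong (_+ _) (sym b₁)) (occ-v+x B b≢a))

    gap-structure : Neighbours a v ⊎ length x ≡ 2
    gap-structure with distant-0-or-2 (D-letter 0) (D-distant z≤n)
    ... | inj₁ D₀ = inj₁ (word-of-pair v (≢-sym (next≢prev A))
            (only-neighbours v (λ y∈v → there (∈-++⁺ˡ y∈v)) v₀ (λ Y far → trans (distant-occ Y far) D₀))
            (neighbour-once P (inj₂ refl)) (neighbour-once S (inj₁ refl)))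
      where
      P : Letter (prev a)
      P = prev-letter A
      S : Letter (next a)
      S = next-letter A
    ... | inj₂ D₂ = inj₂ ([ cong length , cong length ]′ (word-of-pair x (≢-sym (next≢prev A))
            (only-neighbours x (λ y∈x → there (∈-++⁺ʳ v (there y∈x))) x₀ far₀)
            (once-v⇒once-x P (prev≢self A) (neighbour-once P (inj₂ refl)))
            (once-v⇒once-x S (next≢self A) (neighbour-once S (inj₁ refl)))))
      where
      P : Letter (prev a)
      P = prev-letter A
      S : Letter (next a)
      S = next-letter A
      far₀ : ∀ {y} → Letter y → Distant a y → occ y x ≡ 0
      far₀ Y far@(y≢a , _) = +-cancelˡ-≡ 2 _ 0
        (trans (cong (_+ _) (sym (trans (distant-occ Y far) D₂))) (trans (occ-v+x Y y≢a) (sym (+-identityʳ 2))))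

  Oriented : (ℕ → ℕ) → (ℕ → ℕ) → ℕ → ℕ → ℕ → Set
  Oriented F G a p q = p ≡ G a × q ≡ F a

  Turn : ℕ → ℕ → ℕ → Set
  Turn a p q = Oriented next prev a p q ⊎ Oriented prev next a p q

  length-valid : ∀ {w} → Valid n w → length w ≡ 2 * n
  length-valid (U , _) = trans (length-uniform U) (*-comm n 2)

  3≤length-valid : ∀ {w} → Valid n w → 3 ≤ length w
  3≤length-valid V = subst (3 ≤_) (sym (length-valid V)) (≤-trans (m≤m+n 3 5) 8≤2n)

  second-occurrence-behind : ∀ {a v x} → Valid n (a ∷ v ++ a ∷ x) → occ a v ≡ 0 → length x ≡ 2 →
    cyc (a ∷ v ++ a ∷ x) (2 * n ∸ 3) ≡ a × cyc (a ∷ v ++ a ∷ x) 3 ≢ a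
  second-occurrence-behind {a} {v} {x} V v₀ |x|≡2 = back , ahead
    where
    w : Word
    w = a ∷ v ++ a ∷ x
    L : ℕ
    L = length v
    |w|≡2n : suc L + 3 ≡ 2 * n
    |w|≡2n = trans (cong (λ l → suc (L + suc l)) (sym |x|≡2)) (trans (cong suc (sym (length-++ v))) (length-valid V))
    |w|≡1+L+3 : length w ≡ suc L + 3
    |w|≡1+L+3 = trans (length-valid V) (sym |w|≡2n)
    2n∸3≡1+L : 2 * n ∸ 3 ≡ suc L
    2n∸3≡1+L = trans (cong (_∸ 3) (sym |w|≡2n)) (m+n∸n≡m (suc L) 3)
    2<L : 2 < L
    2<L with 2 <? L
    ... | yes 2<L = 2<L
    ... | no 2≮L = ⊥-elim (≤⇒≯ (+-monoˡ-≤ 4 (≮⇒≥ 2≮L)) (subst (6 <_) (sym (trans (+-suc L 3) |w|≡2n)) (≤-trans (n≤1+n 7) 8≤2n)))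
    back : cyc w (2 * n ∸ 3) ≡ a
    back = begin
        cyc w (2 * n ∸ 3)
      ≡⟨ cong (cyc w) 2n∸3≡1+L ⟩
        cyc w (suc L)
      ≡⟨ sym (at≡cyc (suc L) w (subst (suc L <_) (sym |w|≡1+L+3) (m<m+n (suc L) (s≤s z≤n)))) ⟩
        at (v ++ a ∷ x) L
      ≡⟨ cong (at (v ++ a ∷ x)) (sym (+-identityʳ L)) ⟩
        at (v ++ a ∷ x) (L + 0)
      ≡⟨ at-++ʳ v (a ∷ x) 0 ⟩
        a
      ∎
      where open ≡-Reasoning
    ahead : cyc w 3 ≢ a
    ahead e = occ≡0⇒∉ v₀ (subst (_∈ v) a-in-v (at-∈ v 2 2<L))
      where
      a-in-v : at v 2 ≡ a
      a-in-v = trans (sym (at-++ˡ v (a ∷ x) 2 2<L))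
                 (trans (at≡cyc 3 w (subst (3 <_) (sym |w|≡1+L+3) (s≤s (≤-trans 2<L (m≤m+n L 3))))) e)

  local-structure : ∀ {w} → Valid n w →
    (cyc w 3 ≡ cyc w 0 × Turn (cyc w 0) (cyc w 1) (cyc w 2)) ⊎
    (cyc w (2 * n ∸ 3) ≡ cyc w 0 × cyc w 3 ≢ cyc w 0)
  local-structure {[]} V = ⊥-elim (0≢1+n (length-valid V))
  local-structure {a ∷ t} V@((inAlph , twice) , _)
    with occ≡1⇒split a t (suc-injective (trans (sym (occ-here {a} t refl)) (twice a (inAlph a (here refl)))))
  ... | v , x , refl , v₀ , x₀ with Gap.gap-structure V v₀ x₀
  ...   | inj₁ (inj₁ refl) = inj₁ (refl , inj₁ (refl , refl))
  ...   | inj₁ (inj₂ refl) = inj₁ (refl , inj₂ (refl , refl))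
  ...   | inj₂ |x|≡2 = inj₂ (second-occurrence-behind V v₀ |x|≡2)

  3+[2n∸3]≡2n : 3 + (2 * n ∸ 3) ≡ 2 * n
  3+[2n∸3]≡2n = m+[n∸m]≡n (s≤s (s≤s (s≤s z≤n)))

  module Recurrence (c : ℕ → ℕ) (letter : ∀ j → Letter (c j)) (periodic : ∀ j → c (2 * n + j) ≡ c j)
    (local : ∀ j → (c (3 + j) ≡ c j × Turn (c j) (c (1 + j)) (c (2 + j))) ⊎
                   (c ((2 * n ∸ 3) + j) ≡ c j × c (3 + j) ≢ c j)) where

    ShortGap : ℕ → Set
    ShortGap j = c (3 + j) ≡ c j

    turn : ∀ {j} → ShortGap j → Turn (c j) (c (1 + j)) (c (2 + j))
    turn {j} t with local j
    ... | inj₁ (_ , tr) = tr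
    ... | inj₂ (_ , ¬t) = ⊥-elim (¬t t)

    long-gap⇒short-gap-behind : ∀ {j} → ¬ ShortGap j → ShortGap ((2 * n ∸ 3) + j)
    long-gap⇒short-gap-behind {j} ¬t with local j
    ... | inj₁ (t , _) = ⊥-elim (¬t t)
    ... | inj₂ (back , _) = trans (cong (λ i → c (i + j)) 3+[2n∸3]≡2n) (trans (periodic j) (sym back))

    ¬consecutive-short-gaps : ∀ {j} → ShortGap j → ShortGap (1 + j) → ⊥
    ¬consecutive-short-gaps {j} t t₁ with turn t | turn t₁
    ... | inj₁ (b≡pa , d≡sa) | inj₁ (d≡pb , _) = next≢prev² A (trans (sym d≡sa) (trans d≡pb (cong prev b≡pa)))
      where A = letter j
    ... | inj₁ (b≡pa , _) | inj₂ (_ , e≡pb) = prev²≢self A (trans (cong prev (sym b≡pa)) (trans (sym e≡pb) t))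
      where A = letter j
    ... | inj₂ (b≡sa , d≡pa) | inj₁ (d≡pb , _) =
      prev≢self A (trans (sym d≡pa) (trans d≡pb (trans (cong prev b≡sa) (prev-next A))))
      where A = letter j
    ... | inj₂ (b≡sa , d≡pa) | inj₂ (d≡sb , _) = next²≢prev A (trans (cong next (sym b≡sa)) (trans (sym d≡sb) d≡pa))
      where A = letter j

    short-gap-+2 : ∀ {j} → ShortGap j → ShortGap (2 + j)
    short-gap-+2 {j} t with c (3 + (2 + j)) ≟ c (2 + j)
    ... | yes t₂ = t₂
    ... | no ¬t₂ = ⊥-elim (¬consecutive-short-gaps (long-gap⇒short-gap-behind (¬consecutive-short-gaps t))
                             (subst ShortGap (+-suc (2 * n ∸ 3) (1 + j)) (long-gap⇒short-gap-behind ¬t₂)))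

    short-gap-0-or-1 : ShortGap 0 ⊎ ShortGap 1
    short-gap-0-or-1 with c 3 ≟ c 0 | c 4 ≟ c 1
    ... | yes t₀ | _ = inj₁ t₀
    ... | no _ | yes t₁ = inj₂ t₁
    ... | no ¬t₀ | no ¬t₁ = ⊥-elim (¬consecutive-short-gaps (long-gap⇒short-gap-behind ¬t₀) (subst ShortGap (+-suc (2 * n ∸ 3) 0) (long-gap⇒short-gap-behind ¬t₁)))

    short-gap-+2* : ∀ {j₀} → ShortGap j₀ → ∀ i → ShortGap (2 * i + j₀)
    short-gap-+2* t zero = t
    short-gap-+2* {j₀} t (suc i) = subst ShortGap (cong (_+ j₀) (sym (*-suc 2 i))) (short-gap-+2 (short-gap-+2* t i))

    module Orientation (F G : ℕ → ℕ) (F∘G : ∀ {a} → Letter a → F (G a) ≡ a) (F²≢id : ∀ {a} → Letter a → F (F a) ≢ a)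
      (oriented : ∀ {j} → ShortGap j → Oriented F G (c j) (c (1 + j)) (c (2 + j)) ⊎ Oriented G F (c j) (c (1 + j)) (c (2 + j)))
      where

      Dir : ℕ → Set
      Dir j = Oriented F G (c j) (c (1 + j)) (c (2 + j))

      Dir-+2 : ∀ {j} → ShortGap j → Dir j → Dir (2 + j)
      Dir-+2 {j} t (_ , d≡Fa) with oriented (short-gap-+2 t)
      ... | inj₁ dir = dir
      ... | inj₂ (e≡Fd , _) = ⊥-elim (F²≢id (letter j) (trans (cong F (sym d≡Fa)) (trans (sym e≡Fd) t)))

      Dir-even : ∀ {j₀} → ShortGap j₀ → Dir j₀ → ∀ i → Dir (2 * i + j₀)
      Dir-even t dir zero = dir
      Dir-even {j₀} t dir (suc i) = subst Dir (cong (_+ j₀) (sym (*-suc 2 i))) (Dir-+2 (short-gap-+2* t i) (Dir-even t dir i))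

      recurrent-from : ∀ {j₀} → ShortGap j₀ → Dir j₀ → ∀ d → c (2 + (d + j₀)) ≡ F (c (d + j₀))
      recurrent-from {j₀} t dir d with parity d
      ... | i , inj₁ refl = proj₂ (Dir-even t dir i)
      ... | i , inj₂ refl = begin
          c (3 + (2 * i + j₀))
        ≡⟨ short-gap-+2* t i ⟩
          c (2 * i + j₀)
        ≡⟨ sym (F∘G (letter _)) ⟩
          F (G (c (2 * i + j₀)))
        ≡⟨ cong F (sym (proj₁ (Dir-even t dir i))) ⟩
          F (c (1 + (2 * i + j₀)))
        ∎
        where open ≡-Reasoning

      recurrent : ∀ {j₀} → j₀ ≤ 2 * n → ShortGap j₀ → Dir j₀ → Recurrent F c
      recurrent {j₀} j₀≤2n t dir q = begin
          c (2 + q)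
        ≡⟨ sym (periodic (2 + q)) ⟩
          c (2 * n + (2 + q))
        ≡⟨ cong c (x∙yz≈y∙xz (2 * n) 2 q) ⟩
          c (2 + (2 * n + q))
        ≡⟨ cong (λ i → c (2 + i)) (sym shift) ⟩
          c (2 + (d + j₀))
        ≡⟨ recurrent-from t dir d ⟩
          F (c (d + j₀))
        ≡⟨ cong (F ∘ c) shift ⟩
          F (c (2 * n + q))
        ≡⟨ cong F (periodic q) ⟩
          F (c q)
        ∎
        where
        open ≡-Reasoning
        d : ℕ
        d = 2 * n + q ∸ j₀
        shift : d + j₀ ≡ 2 * n + q
        shift = m∸n+n≡m (≤-trans j₀≤2n (m≤m+n _ q))

    module Forward = Orientation next prev next-prev next²≢self turn
    module Backward = Orientation prev next prev-next prev²≢self (λ t → swap (turn t))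

    recurrence : (Recurrent next c × (c 1 ≡ prev (c 0) ⊎ c 1 ≡ next (next (c 0)))) ⊎ Recurrent prev c
    recurrence with short-gap-0-or-1
    ... | inj₁ t₀ with turn t₀
    ...   | inj₁ dir = inj₁ (Forward.recurrent z≤n t₀ dir , inj₁ (proj₁ dir))
    ...   | inj₂ dir = inj₂ (Backward.recurrent z≤n t₀ dir)
    recurrence | inj₂ t₁ with turn t₁
    ...   | inj₂ dir = inj₂ (Backward.recurrent (s≤s z≤n) t₁ dir)
    ...   | inj₁ dir = inj₁ (rec , inj₂ (begin
        c 1
      ≡⟨ sym (next-prev (letter 1)) ⟩
        next (prev (c 1))
      ≡⟨ cong next (sym (proj₁ dir)) ⟩
        next (c 2)
      ≡⟨ cong next (rec 0) ⟩
        next (next (c 0))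
      ∎))
      where
      open ≡-Reasoning
      rec : Recurrent next c
      rec = Forward.recurrent (s≤s z≤n) t₁ dir

  cyc-letter : ∀ {w} → Valid n w → ∀ j → Letter (cyc w j)
  cyc-letter {w} V j = proj₁ (proj₁ (valid-rot j V)) _
    (at-∈ (rot j w) 0 (subst (0 <_) (sym (trans (length-rot j w) (length-valid V))) (s≤s z≤n)))

  recurrence-of-valid : ∀ {w} → Valid n w →
    (Recurrent next (cyc w) × (cyc w 1 ≡ prev (cyc w 0) ⊎ cyc w 1 ≡ next (next (cyc w 0)))) ⊎
    Recurrent prev (cyc w)
  recurrence-of-valid {w} V = Recurrence.recurrence (cyc w) (cyc-letter V) periodic local
    where
    shifted : ∀ j i → cyc (rot j w) i ≡ cyc w (i + j)
    shifted j i = trans (cyc-rot w j i) (cong (cyc w) (+-comm j i))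
    periodic : ∀ j → cyc w (2 * n + j) ≡ cyc w j
    periodic j = trans (cong (λ l → cyc w (l + j)) (sym (length-valid V))) (cyc-periodic w j)
    local : ∀ j → (cyc w (3 + j) ≡ cyc w j × Turn (cyc w j) (cyc w (1 + j)) (cyc w (2 + j))) ⊎
                  (cyc w ((2 * n ∸ 3) + j) ≡ cyc w j × cyc w (3 + j) ≢ cyc w j)
    local j with local-structure (valid-rot j V)
    ... | inj₁ (t , tr) = inj₁ (trans (sym (shifted j 3)) t ,
                                subst₂ (Turn (cyc w j)) (shifted j 1) (shifted j 2) tr)
    ... | inj₂ (back , ¬t) = inj₂ (trans (sym (shifted j (2 * n ∸ 3))) back ,
                                   λ t → ¬t (trans (shifted j 3) t))

  blocks : ℕ → Word
  blocks zero = []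
  blocks (suc K) = blocks K ++ suc K ∷ prev (suc K) ∷ []

  blocks-suc : ∀ K → blocks (suc K) ≡ 1 ∷ n ∷ concatMap (λ i → (i + 2) ∷ (i + 1) ∷ []) (upTo K)
  blocks-suc zero = refl
  blocks-suc (suc K) = begin
      blocks (suc K) ++ block K
    ≡⟨ cong (_++ block K) (blocks-suc K) ⟩
      1 ∷ n ∷ (concatMap f (upTo K) ++ block K)
    ≡⟨ cong (λ r → 1 ∷ n ∷ (concatMap f (upTo K) ++ r)) (sym (trans (++-identityʳ (f K)) f≡block)) ⟩
      1 ∷ n ∷ (concatMap f (upTo K) ++ concatMap f [ K ])
    ≡⟨ cong (λ r → 1 ∷ n ∷ r) (sym (concatMap-++ f (upTo K) [ K ])) ⟩
      1 ∷ n ∷ concatMap f (upTo K ∷ʳ K)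
    ≡⟨ cong (λ r → 1 ∷ n ∷ concatMap f r) (upTo-∷ʳ K) ⟩
      1 ∷ n ∷ concatMap f (upTo (suc K))
    ∎
    where
    open ≡-Reasoning
    f : ℕ → Word
    f i = (i + 2) ∷ (i + 1) ∷ []
    block : ℕ → Word
    block i = (2 + i) ∷ (1 + i) ∷ []
    f≡block : f K ≡ block K
    f≡block = cong₂ (λ p q → p ∷ q ∷ []) (+-comm K 2) (+-comm K 1)

  W : Word
  W = wordW n

  W≡blocks : W ≡ blocks n
  W≡blocks = sym (blocks-suc (3 + k))

  length-blocks : ∀ K → length (blocks K) ≡ 2 * K
  length-blocks zero = refl
  length-blocks (suc K) = trans (length-++ (blocks K))
    (trans (cong (_+ 2) (length-blocks K)) (trans (+-comm (2 * K) 2) (sym (*-suc 2 K))))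

  at-blocks-even : ∀ K a → a < K → at (blocks K) (2 * a) ≡ suc a
  at-blocks-even (suc K) a a<1+K with m≤n⇒m<n∨m≡n (≤-pred a<1+K)
  ... | inj₁ a<K = trans (at-++ˡ (blocks K) _ (2 * a) (subst (2 * a <_) (sym (length-blocks K)) (*-monoʳ-< 2 a<K)))
                         (at-blocks-even K a a<K)
  ... | inj₂ refl = subst (λ i → at (blocks (suc a)) i ≡ suc a) (trans (+-identityʳ _) (length-blocks a))
                          (at-++ʳ (blocks a) _ 0)

  at-blocks-odd : ∀ K a → a < K → at (blocks K) (1 + 2 * a) ≡ prev (suc a)
  at-blocks-odd (suc K) a a<1+K with m≤n⇒m<n∨m≡n (≤-pred a<1+K)
  ... | inj₁ a<K = trans (at-++ˡ (blocks K) _ (1 + 2 * a) (subst (1 + 2 * a <_) (sym (length-blocks K)) 1+2a<2K))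
                         (at-blocks-odd K a a<K)
    where
    1+2a<2K : 1 + 2 * a < 2 * K
    1+2a<2K = subst (_≤ 2 * K) (*-suc 2 a) (*-monoʳ-≤ 2 a<K)
  ... | inj₂ refl = subst (λ i → at (blocks (suc a)) i ≡ prev (suc a)) (trans (+-comm _ 1) (cong suc (length-blocks a)))
                          (at-++ʳ (blocks a) _ 1)

  letters-blocks : ∀ K → K ≤ n → ∀ {y} → y ∈ blocks K → Letter y
  letters-blocks (suc K) K<n y∈ with ∈-++⁻ (blocks K) y∈
  ... | inj₁ y∈blocks = letters-blocks K (<⇒≤ K<n) y∈blocks
  ... | inj₂ (here refl) = s≤s z≤n , K<n
  ... | inj₂ (there (here refl)) = prev-letter (s≤s z≤n , K<n)

  occ-blocks : ∀ {b} K → Letter b → K ≤ n → occ b (blocks K) ≡ occ b (ascending K) + occ (next b) (ascending K)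
  occ-blocks zero _ _ = refl
  occ-blocks {b} (suc K) B K<n = begin
      occ b (blocks K ++ suc K ∷ prev (suc K) ∷ [])
    ≡⟨ trans (occ-++ b (blocks K) _) (cong (occ b (blocks K) +_) (occ-++ b [ suc K ] [ prev (suc K) ])) ⟩
      occ b (blocks K) + (occ b [ suc K ] + occ b [ prev (suc K) ])
    ≡⟨ cong₂ (λ p q → p + (occ b [ suc K ] + q)) (occ-blocks K B (<⇒≤ K<n)) (occ-singleton-⇔ prev⇔next) ⟩
      (occ b (ascending K) + occ (next b) (ascending K)) + (occ b [ suc K ] + occ (next b) [ suc K ])
    ≡⟨ interchange (occ b (ascending K)) _ _ _ ⟩
      (occ b (ascending K) + occ b [ suc K ]) + (occ (next b) (ascending K) + occ (next b) [ suc K ])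
    ≡⟨ sym (cong₂ _+_ (occ-++ b (ascending K) _) (occ-++ (next b) (ascending K) _)) ⟩
      occ b (ascending (suc K)) + occ (next b) (ascending (suc K))
    ∎
    where
    open ≡-Reasoning
    prev⇔next : prev (suc K) ≡ b ⇔ suc K ≡ next b
    prev⇔next = mk⇔ (λ e → trans (sym (next-prev (s≤s z≤n , K<n))) (cong next e))
                    (λ e → trans (cong prev e) (prev-next B))

  W-uniform : Uniform 2 n W
  W-uniform = (λ y y∈W → letters-blocks n ≤-refl (subst (y ∈_) W≡blocks y∈W)) , twice
    where
    twice : ∀ b → Letter b → occ b W ≡ 2
    twice b B@(1≤b , b≤n) = trans (cong (occ b) W≡blocks) (trans (occ-blocks n B ≤-refl)
      (cong₂ _+_ (occ-ascending-within n 1≤b b≤n) (occ-ascending-within n (proj₁ S) (proj₂ S))))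
      where S = next-letter B

  length-W : length W ≡ 2 * n
  length-W = trans (cong length W≡blocks) (length-blocks n)

  cyc-W-even : ∀ {a} → a < n → cyc W (2 * a) ≡ suc a
  cyc-W-even {a} a<n = trans (sym (at≡cyc (2 * a) W (subst (2 * a <_) (sym length-W) (*-monoʳ-< 2 a<n))))
    (trans (cong (λ z → at z (2 * a)) W≡blocks) (at-blocks-even n a a<n))

  cyc-W-odd : ∀ {a} → a < n → cyc W (1 + 2 * a) ≡ prev (suc a)
  cyc-W-odd {a} a<n = trans (sym (at≡cyc (1 + 2 * a) W (subst (1 + 2 * a <_) (sym length-W) 1+2a<2n)))
    (trans (cong (λ z → at z (1 + 2 * a)) W≡blocks) (at-blocks-odd n a a<n))
    where
    1+2a<2n : 1 + 2 * a < 2 * n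
    1+2a<2n = subst (_≤ 2 * n) (*-suc 2 a) (*-monoʳ-≤ 2 a<n)

  cyc-W-periodic : ∀ q → cyc W (2 * n + q) ≡ cyc W q
  cyc-W-periodic q = trans (cong (λ l → cyc W (l + q)) (sym length-W)) (cyc-periodic W q)

  W-recurrent-even : ∀ {a} → a < n → cyc W (2 + 2 * a) ≡ next (cyc W (2 * a))
  W-recurrent-even {a} a<n with m≤n⇒m<n∨m≡n a<n
  ... | inj₁ 1+a<n = begin
      cyc W (2 + 2 * a)
    ≡⟨ cong (cyc W) (sym (*-suc 2 a)) ⟩
      cyc W (2 * suc a)
    ≡⟨ cyc-W-even 1+a<n ⟩
      suc (suc a)
    ≡⟨ sym (next-< 1+a<n) ⟩
      next (suc a)
    ≡⟨ cong next (sym (cyc-W-even a<n)) ⟩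
      next (cyc W (2 * a))
    ∎
    where open ≡-Reasoning
  ... | inj₂ refl = begin
      cyc W (2 + 2 * a)
    ≡⟨ cong (cyc W) (trans (sym (*-suc 2 a)) (sym (+-identityʳ _))) ⟩
      cyc W (2 * n + 0)
    ≡⟨ cyc-W-periodic 0 ⟩
      1
    ≡⟨ sym next-n ⟩
      next (suc a)
    ≡⟨ cong next (sym (cyc-W-even a<n)) ⟩
      next (cyc W (2 * a))
    ∎
    where open ≡-Reasoning

  W-recurrent-odd : ∀ {a} → a < n → cyc W (3 + 2 * a) ≡ next (cyc W (1 + 2 * a))
  W-recurrent-odd {a} a<n with m≤n⇒m<n∨m≡n a<n
  ... | inj₁ 1+a<n = begin
      cyc W (3 + 2 * a)
    ≡⟨ cong (λ i → cyc W (1 + i)) (sym (*-suc 2 a)) ⟩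
      cyc W (1 + 2 * suc a)
    ≡⟨ cyc-W-odd 1+a<n ⟩
      suc a
    ≡⟨ sym (next-prev (s≤s z≤n , a<n)) ⟩
      next (prev (suc a))
    ≡⟨ cong next (sym (cyc-W-odd a<n)) ⟩
      next (cyc W (1 + 2 * a))
    ∎
    where open ≡-Reasoning
  ... | inj₂ refl = begin
      cyc W (3 + 2 * a)
    ≡⟨ cong (cyc W) (trans (cong suc (sym (*-suc 2 a))) (+-comm 1 _)) ⟩
      cyc W (2 * n + 1)
    ≡⟨ cyc-W-periodic 1 ⟩
      n
    ≡⟨ sym (next-prev (s≤s z≤n , ≤-refl)) ⟩
      next (prev (suc a))
    ≡⟨ cong next (sym (cyc-W-odd a<n)) ⟩
      next (cyc W (1 + 2 * a))
    ∎
    where open ≡-Reasoning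

  W-recurrent : Recurrent next (cyc W)
  W-recurrent = recurrent-periodic next (cyc W) (s≤s z≤n) cyc-W-periodic below
    where
    below : ∀ q → q < 2 * n → cyc W (2 + q) ≡ next (cyc W q)
    below q q<2n with parity q
    ... | a , inj₁ refl = W-recurrent-even (*-cancelˡ-< 2 a n q<2n)
    ... | a , inj₂ refl = W-recurrent-odd (*-cancelˡ-< 2 a n (<-trans (n<1+n _) q<2n))

  W-twice : ∀ {b} → Letter b → occ b W ≡ 2
  W-twice B = proj₂ W-uniform _ B

  rot-W-factor : ∀ {a} → Letter a → let z = rot (2 * pred a) W in z ≡ a ∷ prev a ∷ next a ∷ a ∷ drop 4 z
  rot-W-factor {suc a} A@(_ , a<n) = trans (first-four z 4≤|z|)
    (cong₂ _∷_ (trans (cyc-rot W j 0) (trans (cong (cyc W) (+-identityʳ j)) (cyc-W-even a<n)))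
    (cong₂ _∷_ (trans (cyc-rot W j 1) (trans (cong (cyc W) (+-comm j 1)) (cyc-W-odd a<n)))
    (cong₂ _∷_ (trans (cyc-rot W j 2) (trans (cong (cyc W) (+-comm j 2)) (trans (W-recurrent j) (cong next (cyc-W-even a<n)))))
    (cong₂ _∷_ (trans (cyc-rot W j 3) (trans (cong (cyc W) (+-comm j 3))
                 (trans (W-recurrent (1 + j)) (trans (cong next (cyc-W-odd a<n)) (next-prev A)))))
      refl))))
    where
    j : ℕ
    j = 2 * a
    z : Word
    z = rot j W
    4≤|z| : 4 ≤ length z
    4≤|z| = subst (4 ≤_) (sym (trans (length-rot j W) length-W)) (≤-trans (m≤m+n 4 4) 8≤2n)

  W-represents : Represents n W
  W-represents a b A B with a ≟ b
  ... | yes refl = mk⇔ (λ alt → ⊥-elim (¬alternate-self a W (W-twice A) alt))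
    (λ adj → ⊥-elim ([ ≢-sym (next≢self A) , ≢-sym (prev≢self A) ]′ (Equivalence.to (adjacent⇔ A A) adj)))
  ... | no a≢b = ⇔-sym (adjacent⇔ A B) ⇔-∘ (mk⇔ swap swap ⇔-∘ (factor ⇔-∘ alternate-rot a b j W (W-twice A) (W-twice B)))
    where
    j : ℕ
    j = 2 * pred a
    z : Word
    z = rot j W
    x : Word
    x = drop 4 z
    z≡ : z ≡ a ∷ prev a ∷ next a ∷ a ∷ x
    z≡ = rot-W-factor A
    occ-z : ∀ {c} → Letter c → occ c (a ∷ prev a ∷ next a ∷ a ∷ x) ≡ 2
    occ-z C = trans (cong (occ _) (sym z≡)) (trans (occ-rot _ j W) (W-twice C))
    x₀ : occ a x ≡ 0
    x₀ = suc-injective (suc-injective (begin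
        suc (suc (occ a x))
      ≡⟨ cong suc (sym (occ-here {a} x refl)) ⟩
        suc (occ a (a ∷ x))
      ≡⟨ cong suc (sym (trans (occ-there _ (prev≢self A)) (occ-there _ (next≢self A)))) ⟩
        suc (occ a (prev a ∷ next a ∷ a ∷ x))
      ≡⟨ sym (occ-here {a} _ refl) ⟩
        occ a (a ∷ prev a ∷ next a ∷ a ∷ x)
      ≡⟨ occ-z A ⟩
        2
      ∎))
      where open ≡-Reasoning
    factor : Alternate z a b ⇔ (b ≡ prev a ⊎ b ≡ next a)
    factor = subst (λ u → Alternate u a b ⇔ (b ≡ prev a ⊎ b ≡ next a)) (sym z≡)
      (alternate⇔between-pair x a≢b (≢-sym (next≢prev A)) (prev≢self A) (next≢self A) x₀ (occ-z B))

  W-valid : Valid n W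
  W-valid = W-uniform , W-represents

  rotate-W≡rot : ∀ {i} → i < 2 * n → rotate i W ≡ rot i W
  rotate-W≡rot {i} i<2n = rotate≡rot i W (subst (i ≤_) (sym length-W) (<⇒≤ i<2n))

  rotate-W-valid : ∀ {i} → i < 2 * n → Valid n (rotate i W)
  rotate-W-valid {i} i<2n = subst (Valid n) (sym (rotate-W≡rot i<2n)) (valid-rot i W-valid)

  rotate-W-recurrent : ∀ {i} → i < 2 * n → Recurrent next (cyc (rotate i W))
  rotate-W-recurrent {i} i<2n =
    subst (λ z → Recurrent next (cyc z)) (sym (rotate-W≡rot i<2n)) (recurrent-rot {next} W i W-recurrent)

  W-at-letter : ∀ {a} → Letter a → cyc W (2 * pred a) ≡ a × cyc W (1 + 2 * pred a) ≡ prev a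
  W-at-letter {suc a} (_ , a<n) = cyc-W-even a<n , cyc-W-odd a<n

  1+2*pred<2n : ∀ {a} → Letter a → 1 + 2 * pred a < 2 * n
  1+2*pred<2n {suc a} (_ , a<n) = subst (_≤ 2 * n) (*-suc 2 a) (*-monoʳ-≤ 2 a<n)

  rotate-W-from : ∀ {z} i → i < 2 * n → length z ≡ 2 * n → Recurrent next (cyc z) →
    cyc W i ≡ cyc z 0 → cyc W (1 + i) ≡ cyc z 1 → z ≡ rotate i W
  rotate-W-from {z} i i<2n |z| rec e₀ e₁ = begin
      z
    ≡⟨ cyc-ext z (rot i W) (trans |z| (sym (trans (length-rot i W) length-W)))
         (recurrent-ext {next} rec (recurrent-rot {next} W i W-recurrent)
           (sym (trans (cyc-rot W i 0) (trans (cong (cyc W) (+-identityʳ i)) e₀)))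
           (sym (trans (cyc-rot W i 1) (trans (cong (cyc W) (+-comm i 1)) e₁)))) ⟩
      rot i W
    ≡⟨ sym (rotate-W≡rot i<2n) ⟩
      rotate i W
    ∎
    where open ≡-Reasoning

  rotation-of-W : ∀ {z} → length z ≡ 2 * n → Letter (cyc z 0) → Recurrent next (cyc z) →
    cyc z 1 ≡ prev (cyc z 0) ⊎ cyc z 1 ≡ next (next (cyc z 0)) → ∃[ i ] i < 2 * n × z ≡ rotate i W
  rotation-of-W {z} |z| A rec (inj₁ e) = i , i<2n ,
    rotate-W-from i i<2n |z| rec (proj₁ (W-at-letter A)) (trans (proj₂ (W-at-letter A)) (sym e))
    where
    i : ℕ
    i = 2 * pred (cyc z 0)
    i<2n : i < 2 * n
    i<2n = <-trans (n<1+n i) (1+2*pred<2n A)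
  rotation-of-W {z} |z| A rec (inj₂ e) = i , 1+2*pred<2n S ,
    rotate-W-from i (1+2*pred<2n S) |z| rec
      (trans (proj₂ (W-at-letter S)) (prev-next A))
      (trans (W-recurrent (2 * pred (next (cyc z 0)))) (trans (cong next (proj₁ (W-at-letter S))) (sym e)))
    where
    S : Letter (next (cyc z 0))
    S = next-letter A
    i : ℕ
    i = 1 + 2 * pred (next (cyc z 0))

  valid⇒rotation-or-reflection : ∀ {w} → Valid n w → ∃[ i ] i < 2 * n × (w ≡ rotate i W ⊎ w ≡ reverse (rotate i W))
  valid⇒rotation-or-reflection {w} V with recurrence-of-valid V
  ... | inj₁ (rec , start) =
    let (i , i<2n , w≡) = rotation-of-W (length-valid V) (cyc-letter V 0) rec start in i , i<2n , inj₁ w≡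
  ... | inj₂ back with recurrence-of-valid (valid-reverse V)
  ...   | inj₁ (rec , start) =
    let (i , i<2n , w̃≡) = rotation-of-W (length-valid (valid-reverse V)) (cyc-letter (valid-reverse V) 0) rec start
    in i , i<2n , inj₂ (trans (sym (reverse-involutive w)) (cong reverse w̃≡))
  ...   | inj₂ back′ with recurrent-both-ways prev w (3≤length-valid V) back back′
  ...     | x , x∈w , prev²x≡x = ⊥-elim (prev²≢self (proj₁ (proj₁ V) x x∈w) prev²x≡x)

  IndexByLetters : ℕ → Set
  IndexByLetters i = (i ≡ 2 * pred (cyc W i) × cyc W (1 + i) ≡ prev (cyc W i)) ⊎
              (i ≡ 1 + 2 * pred (next (cyc W i)) × cyc W (1 + i) ≡ next (next (cyc W i)))

  W-index : ∀ i → i < 2 * n → IndexByLetters i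
  W-index i i<2n with parity i
  ... | a , inj₁ refl = inj₁ (cong (λ b → 2 * pred b) (sym (cyc-W-even a<n)) , trans (cyc-W-odd a<n) (cong prev (sym (cyc-W-even a<n))))
    where
    a<n : a < n
    a<n = *-cancelˡ-< 2 a n i<2n
  ... | a , inj₂ refl = inj₂ (cong (λ b → 1 + 2 * pred b) (sym next≡) ,
                              trans (W-recurrent (2 * a)) (trans (cong next (cyc-W-even a<n)) (cong next (sym next≡))))
    where
    a<n : a < n
    a<n = *-cancelˡ-< 2 a n (<-trans (n<1+n _) i<2n)
    next≡ : next (cyc W (1 + 2 * a)) ≡ suc a
    next≡ = trans (cong next (cyc-W-odd a<n)) (next-prev (s≤s z≤n , a<n))

  rotate-W-injective : ∀ {i j} → i < 2 * n → j < 2 * n → rotate i W ≡ rotate j W → i ≡ j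
  rotate-W-injective {i} {j} i<2n j<2n eq = cases (W-index i i<2n) (W-index j j<2n)
    where
    same : ∀ q → cyc W (i + q) ≡ cyc W (j + q)
    same q = trans (sym (cyc-rot W i q)) (trans (cong (λ z → cyc z q) (trans (sym (rotate-W≡rot i<2n))
               (trans eq (rotate-W≡rot j<2n)))) (cyc-rot W j q))
    e₀ : cyc W i ≡ cyc W j
    e₀ = subst₂ (λ i′ j′ → cyc W i′ ≡ cyc W j′) (+-identityʳ i) (+-identityʳ j) (same 0)
    e₁ : cyc W (1 + i) ≡ cyc W (1 + j)
    e₁ = subst₂ (λ i′ j′ → cyc W i′ ≡ cyc W j′) (+-comm i 1) (+-comm j 1) (same 1)
    A : Letter (cyc W i)
    A = cyc-letter W-valid i
    cases : IndexByLetters i → IndexByLetters j → i ≡ j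
    cases (inj₁ (i≡ , _)) (inj₁ (j≡ , _)) = trans i≡ (trans (cong (λ a → 2 * pred a) e₀) (sym j≡))
    cases (inj₂ (i≡ , _)) (inj₂ (j≡ , _)) = trans i≡ (trans (cong (λ a → 1 + 2 * pred (next a)) e₀) (sym j≡))
    cases (inj₁ (_ , pᵢ)) (inj₂ (_ , sⱼ)) =
      ⊥-elim (next²≢prev A (trans (cong (next ∘ next) e₀) (trans (sym sⱼ) (trans (sym e₁) pᵢ))))
    cases (inj₂ (_ , sᵢ)) (inj₁ (_ , pⱼ)) =
      ⊥-elim (next²≢prev A (trans (sym sᵢ) (trans e₁ (trans pⱼ (cong prev (sym e₀))))))

  rotation≢reflection : ∀ {i j} → i < 2 * n → j < 2 * n → rotate i W ≢ reverse (rotate j W)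
  rotation≢reflection {i} {j} i<2n j<2n eq =
    let (x , x∈z , next²x≡x) = recurrent-both-ways next (rotate j W) (3≤length-valid (rotate-W-valid j<2n))
                                 (rotate-W-recurrent j<2n) (subst (λ z → Recurrent next (cyc z)) eq (rotate-W-recurrent i<2n))
    in next²≢self (proj₁ (proj₁ (rotate-W-valid j<2n)) x x∈z) next²x≡x

  rotations : List Word
  rotations = applyUpTo (λ i → rotate i W) (2 * n)

  reflections : List Word
  reflections = applyUpTo (λ i → reverse (rotate i W)) (2 * n)

  unique-rotations-reflections : Unique (rotations ++ reflections)
  unique-rotations-reflections = AllPairsₚ.++⁺
    (AllPairsₚ.applyUpTo⁺₁ (λ i → rotate i W) (2 * n) λ i<j j<2n eq → <⇒≢ i<j (rotate-W-injective (<-trans i<j j<2n) j<2n eq))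
    (AllPairsₚ.applyUpTo⁺₁ (λ i → reverse (rotate i W)) (2 * n) λ i<j j<2n eq →
      <⇒≢ i<j (rotate-W-injective (<-trans i<j j<2n) j<2n (reverse-injective eq)))
    (Allₚ.applyUpTo⁺₁ (λ i → rotate i W) (2 * n) λ i<2n →
      Allₚ.applyUpTo⁺₁ (λ j → reverse (rotate j W)) (2 * n) λ j<2n → rotation≢reflection i<2n j<2n)

  length-rotations-reflections : length (rotations ++ reflections) ≡ 4 * n
  length-rotations-reflections = trans (length-++ rotations)
    (trans (cong₂ _+_ (length-applyUpTo (λ i → rotate i W) (2 * n)) (length-applyUpTo (λ i → reverse (rotate i W)) (2 * n)))
      (sym (*-distribʳ-+ n 2 2)))

  ∈-rotations-reflections⇔valid : ∀ w → w ∈ rotations ++ reflections ⇔ Valid n w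
  ∈-rotations-reflections⇔valid w = mk⇔ to from
    where
    to : w ∈ rotations ++ reflections → Valid n w
    to w∈ with ∈-++⁻ rotations w∈
    ... | inj₁ w∈rot with ∈-applyUpTo⁻ (λ i → rotate i W) w∈rot
    ...   | i , i<2n , refl = rotate-W-valid i<2n
    to w∈ | inj₂ w∈ref with ∈-applyUpTo⁻ (λ i → reverse (rotate i W)) w∈ref
    ...   | i , i<2n , refl = valid-reverse (rotate-W-valid i<2n)
    from : Valid n w → w ∈ rotations ++ reflections
    from V with valid⇒rotation-or-reflection V
    ... | i , i<2n , inj₁ refl = ∈-++⁺ˡ (∈-applyUpTo⁺ (λ i → rotate i W) i<2n)
    ... | i , i<2n , inj₂ refl = ∈-++⁺ʳ rotations (∈-applyUpTo⁺ (λ i → reverse (rotate i W)) i<2n)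

theorem1 : (n : ℕ) → 3 < n →
    (Σ (List Word) λ L → Unique L × length L ≡ 4 * n
        × (∀ w → (w ∈ L ⇔ (Uniform 2 n w × Represents n w))))
    × (∀ w → Uniform 2 n w → Represents n w →
        ∃[ i ] (i < 2 * n) × ((w ≡ rotate i (wordW n)) ⊎ (w ≡ reverse (rotate i (wordW n)))))
theorem1 (suc (suc (suc (suc k)))) _ =
  (rotations ++ reflections , unique-rotations-reflections , length-rotations-reflections , ∈-rotations-reflections⇔valid) ,
  λ w U R → valid⇒rotation-or-reflection (U , R)
  where open Cycle k
theorem1 1 (s≤s ())
theorem1 2 (s≤s (s≤s ()))
theorem1 3 (s≤s (s≤s (s≤s ())))
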